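{- For $n = 6k+1$ with $k \geq 3$, the graph $\mathscr{I}(C_n)$ is Hamilton traceable, i.e. it has a Hamiltonian path.
   Context: For a graph $G$, an $i$-set is an independent dominating set of minimum size. The $i$-graph $\mathscr{I}(G)$ has the $i$-sets of $G$ as vertices, with $X,Y$ adjacent if and only if there is an edge $xy\in E(G)$ with $x\in X$, $y \notin X$ and $Y=(X\setminus\{x\})\cup\{y\}$. $C_n$ is the cycle on $n$ vertices. -}

module Defs where

open import Data.Nat using (ℕ; zero; suc; _≤_)
open import Data.Fin using (Fin; toℕ)
open import Data.Fin.Subset using (Subset; _∈_; _∉_; ⁅_⁆; _∪_; _─_; ∣_∣)
open import Data.Product using (Σ; ∃; _×_)
open import Data.Sum using (_⊎_)
open import Data.List using (List)
open import Data.List.Relation.Unary.All using (All)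
open import Data.List.Relation.Unary.Linked using (Linked)
open import Data.List.Relation.Unary.Unique.Propositional using (Unique)
import Data.List.Membership.Propositional as LM
open import Relation.Nullary using (¬_)
open import Relation.Binary.PropositionalEquality using (_≡_)

SuccRel : (n : ℕ) → Fin n → Fin n → Set
SuccRel n i j = (suc (toℕ i) ≡ toℕ j) ⊎ (suc (toℕ i) ≡ n × toℕ j ≡ 0)

CycleAdj : (n : ℕ) → Fin n → Fin n → Set
CycleAdj n i j = SuccRel n i j ⊎ SuccRel n j i

module _ {n : ℕ} (E : Fin n → Fin n → Set) where

  Independent : Subset n → Set
  Independent X = ∀ x y → x ∈ X → y ∈ X → ¬ E x y

  Dominating : Subset n → Set
  Dominating X = ∀ v → v ∈ X ⊎ (∃ λ u → u ∈ X × E u v)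

  IndepDominating : Subset n → Set
  IndepDominating X = Independent X × Dominating X

  ISet : Subset n → Set
  ISet X = IndepDominating X × (∀ Y → IndepDominating Y → ∣ X ∣ ≤ ∣ Y ∣)

  IAdj : Subset n → Subset n → Set
  IAdj X Y = ∃ λ x → ∃ λ y → E x y × x ∈ X × y ∉ X × Y ≡ (X ─ ⁅ x ⁆) ∪ ⁅ y ⁆

  IGraphHamiltonPath : List (Subset n) → Set
  IGraphHamiltonPath L =
    All ISet L × Unique L × (∀ X → ISet X → X LM.∈ L) × Linked IAdj L

  IGraphTraceable : Set
  IGraphTraceable = ∃ λ L → IGraphHamiltonPath L

-- For n = 3T + 1 an i-set of C_n has T + 1 tokens, and counting the windows of three consecutive
-- vertices gives 3(T + 1) = n + (number of gaps of length 2): every i-set has exactly two gaps of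
-- length 2, all other gaps having length 3. Such a configuration is determined by one 2-gap and the
-- distance 3m + 2 to the next, so for n = 6K + 7 the i-sets are the rotations of the canonical sets
-- m = 0, …, K, indexed by (m, t) through the rotation by 3t (3 is invertible modulo n). Three token
-- slides connect them: moving the token at 3m + 2 back by one lowers m; moving the token at 0 to
-- n − 1 raises m and rotates by 3; on the top level m = K the latter rotates by 3K + 5. Zig-zagging
-- between the levels 2i and 2i + 1, and running through the top level with its rotations, gives a
-- Hamiltonian path.
module Submission where

open import Data.Bool using (Bool; true; false; _∧_; _∨_; if_then_else_)
open import Data.Bool.Properties using (T-≡; ∧-conicalˡ; ∧-conicalʳ; ∧-zeroʳ; ∨-zeroʳ; ∨-identityʳ)
open import Data.Empty using (⊥; ⊥-elim)
open import Data.Fin using (Fin; zero; suc; toℕ; fromℕ<) renaming (_≟_ to _≟ᶠ_)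
open import Data.Fin.Properties using (toℕ-injective; toℕ<n; toℕ-fromℕ<)
open import Data.Fin.Subset using (Subset; _∈_; _∉_; ⁅_⁆; _∪_; _─_; ∣_∣)
open import Data.Fin.Subset.Properties using (x∈⁅x⁆; x≢y⇒x∉⁅y⁆)
open import Data.List using (List; []; _∷_; _++_; map)
open import Data.List.Properties using (++-assoc)
open import Data.List.Membership.Propositional using () renaming (_∈_ to _∈ₗ_)
open import Data.List.Membership.Propositional.Properties using (∈-++⁺ˡ; ∈-++⁺ʳ; ∈-map⁺)
open import Data.List.Relation.Unary.All as All using (All; []; _∷_)
import Data.List.Relation.Unary.All.Properties as All
open import Data.List.Relation.Unary.AllPairs using (AllPairs; []; _∷_)
import Data.List.Relation.Unary.AllPairs.Properties as AllPairs
open import Data.List.Relation.Unary.Any using (here; there)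
open import Data.List.Relation.Unary.Linked using (Linked; []; [-]; _∷_)
import Data.List.Relation.Unary.Linked.Properties as Linked
open import Data.Nat
open import Data.Nat.DivMod
open import Data.Nat.Properties
open import Algebra.Properties.CommutativeSemigroup +-commutativeSemigroup using (interchange)
open import Data.Nat.Divisibility using (n∣m*n)
open import Data.Nat.Tactic.RingSolver using (solve-∀)
open import Data.Product using (Σ; ∃; _×_; _,_; proj₁; proj₂)
open import Data.Sum using (_⊎_; inj₁; inj₂)
open import Data.Vec using ([]; _∷_; lookup; tabulate)
open import Data.Vec.Properties using (lookup⇒[]=; []=⇒lookup; lookup∘tabulate; tabulate∘lookup; tabulate-cong)
open import Function using (Equivalence; _∘_)
open import Relation.Binary.PropositionalEquality
open import Relation.Binary.Definitions using (tri<; tri≈; tri>)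
open import Relation.Nullary using (¬_; yes; no)

open import Defs

𝟙 : Bool → ℕ
𝟙 true = 1
𝟙 false = 0

true≢false : true ≢ false
true≢false ()

≡ᵇ-refl : ∀ a → (a ≡ᵇ a) ≡ true
≡ᵇ-refl a = Equivalence.to T-≡ (≡⇒≡ᵇ a a refl)

≡ᵇ-true⇒≡ : ∀ a b → (a ≡ᵇ b) ≡ true → a ≡ b
≡ᵇ-true⇒≡ a b p = ≡ᵇ⇒≡ a b (Equivalence.from T-≡ p)

≢⇒≡ᵇ-false : ∀ a b → a ≢ b → (a ≡ᵇ b) ≡ false
≢⇒≡ᵇ-false a b a≢b with a ≡ᵇ b in e
... | true = ⊥-elim (a≢b (≡ᵇ-true⇒≡ a b e))
... | false = refl

≤⇒≤ᵇ-true : ∀ {a b} → a ≤ b → (a ≤ᵇ b) ≡ true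
≤⇒≤ᵇ-true a≤b = Equivalence.to T-≡ (≤⇒≤ᵇ a≤b)

≤ᵇ-true⇒≤ : ∀ a b → (a ≤ᵇ b) ≡ true → a ≤ b
≤ᵇ-true⇒≤ a b p = ≤ᵇ⇒≤ a b (Equivalence.from T-≡ p)

>⇒≤ᵇ-false : ∀ {a b} → b < a → (a ≤ᵇ b) ≡ false
>⇒≤ᵇ-false {a} {b} b<a with a ≤ᵇ b in e
... | true = ⊥-elim (<⇒≱ b<a (≤ᵇ-true⇒≤ a b e))
... | false = refl

≤ᵇ-≡ : ∀ {a b c d} → (a ≤ b → c ≤ d) → (c ≤ d → a ≤ b) → (a ≤ᵇ b) ≡ (c ≤ᵇ d)
≤ᵇ-≡ {a} {b} to from with a ≤? b
... | yes a≤b = trans (≤⇒≤ᵇ-true a≤b) (sym (≤⇒≤ᵇ-true (to a≤b)))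
... | no a≰b = trans (>⇒≤ᵇ-false (≰⇒> a≰b)) (sym (>⇒≤ᵇ-false (≰⇒> (a≰b ∘ from))))

≤ᵇ-suc : ∀ m q → (suc m ≤ᵇ suc q) ≡ (m ≤ᵇ q)
≤ᵇ-suc zero q = refl
≤ᵇ-suc (suc m) q = refl

≤ᵇ-skip : ∀ m q → q ≢ suc m → (suc m ≤ᵇ q) ≡ (suc (suc m) ≤ᵇ q)
≤ᵇ-skip m q q≢ = ≤ᵇ-≡ (λ m<q → ≤∧≢⇒< m<q (q≢ ∘ sym)) (≤-trans (n≤1+n _))

≤ᵇ-skip′ : ∀ m q → q ≢ suc m → (q ≤ᵇ m) ≡ (q ≤ᵇ suc m)
≤ᵇ-skip′ m q q≢ = ≤ᵇ-≡ m≤n⇒m≤1+n (λ q≤m+1 → s≤s⁻¹ (≤∧≢⇒< q≤m+1 q≢))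

+-≤ᵇ-self : ∀ K j → (K + j ≤ᵇ K) ≡ (j ≡ᵇ 0)
+-≤ᵇ-self K zero = ≤⇒≤ᵇ-true (≤-reflexive (+-identityʳ K))
+-≤ᵇ-self K (suc j) = >⇒≤ᵇ-false (m<m+n K (s≤s z≤n))

≤ᵇ-antisym : ∀ q m → ((q ≤ᵇ m) ∧ (m ≤ᵇ q)) ≡ (q ≡ᵇ m)
≤ᵇ-antisym q m with <-cmp q m
... | tri< q<m _ _ = trans (cong ((q ≤ᵇ m) ∧_) (>⇒≤ᵇ-false q<m)) (trans (∧-zeroʳ _) (sym (≢⇒≡ᵇ-false q m (<⇒≢ q<m))))
... | tri≈ _ refl _ = trans (cong₂ _∧_ (≤⇒≤ᵇ-true (≤-refl {q})) (≤⇒≤ᵇ-true (≤-refl {q}))) (sym (≡ᵇ-refl q))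
... | tri> _ _ m<q = trans (cong (_∧ (m ≤ᵇ q)) (>⇒≤ᵇ-false m<q)) (sym (≢⇒≡ᵇ-false q m (>⇒≢ m<q)))

≡ᵇ-*3 : ∀ q m → (q * 3 ≡ᵇ m * 3) ≡ (q ≡ᵇ m)
≡ᵇ-*3 zero zero = refl
≡ᵇ-*3 zero (suc m) = refl
≡ᵇ-*3 (suc q) zero = refl
≡ᵇ-*3 (suc q) (suc m) = ≡ᵇ-*3 q m

sumTo : (ℕ → ℕ) → ℕ → ℕ
sumTo f zero = 0
sumTo f (suc l) = sumTo f l + f l

sumTo-head : ∀ f l → sumTo f (suc l) ≡ f 0 + sumTo (λ d → f (suc d)) l
sumTo-head f zero = +-comm 0 (f 0)
sumTo-head f (suc l) = begin
  sumTo f (suc l) + f (suc l)                      ≡⟨ cong (_+ f (suc l)) (sumTo-head f l) ⟩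
  (f 0 + sumTo (λ d → f (suc d)) l) + f (suc l)     ≡⟨ +-assoc (f 0) _ _ ⟩
  f 0 + (sumTo (λ d → f (suc d)) l + f (suc l))     ∎
  where open ≡-Reasoning

sumTo-cong : ∀ {f g} l → (∀ d → d < l → f d ≡ g d) → sumTo f l ≡ sumTo g l
sumTo-cong zero _ = refl
sumTo-cong (suc l) f≡g = cong₂ _+_ (sumTo-cong l (λ d d<l → f≡g d (m<n⇒m<1+n d<l))) (f≡g l ≤-refl)

sumTo-mono-≤ : ∀ {f g} l → (∀ d → d < l → f d ≤ g d) → sumTo f l ≤ sumTo g l
sumTo-mono-≤ zero _ = z≤n
sumTo-mono-≤ (suc l) f≤g = +-mono-≤ (sumTo-mono-≤ l (λ d d<l → f≤g d (m<n⇒m<1+n d<l))) (f≤g l ≤-refl)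

sumTo-+ : ∀ f g l → sumTo (λ d → f d + g d) l ≡ sumTo f l + sumTo g l
sumTo-+ f g zero = refl
sumTo-+ f g (suc l) = begin
  sumTo (λ d → f d + g d) l + (f l + g l)   ≡⟨ cong (_+ (f l + g l)) (sumTo-+ f g l) ⟩
  (sumTo f l + sumTo g l) + (f l + g l)     ≡⟨ interchange (sumTo f l) (sumTo g l) (f l) (g l) ⟩
  (sumTo f l + f l) + (sumTo g l + g l)     ∎
  where open ≡-Reasoning

sumTo-const-1 : ∀ l → sumTo (λ _ → 1) l ≡ l
sumTo-const-1 zero = refl
sumTo-const-1 (suc l) = trans (cong (_+ 1) (sumTo-const-1 l)) (+-comm l 1)

sumTo-rotate : ∀ f N → (∀ d → f (d + N) ≡ f d) → ∀ a → sumTo (λ d → f (a + d)) N ≡ sumTo f N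
sumTo-rotate f N periodic zero = refl
sumTo-rotate f N periodic (suc a) = begin
  sumTo (λ d → f (suc a + d)) N         ≡⟨ sumTo-cong N (λ d _ → cong f (sym (+-suc a d))) ⟩
  sumTo (λ d → f (a + suc d)) N         ≡⟨ rotate-once (λ d → f (a + d)) N wraps ⟩
  sumTo (λ d → f (a + d)) N             ≡⟨ sumTo-rotate f N periodic a ⟩
  sumTo f N                             ∎
  where
  open ≡-Reasoning
  wraps : f (a + N) ≡ f (a + 0)
  wraps = trans (periodic a) (cong f (sym (+-identityʳ a)))
  rotate-once : ∀ g N → g N ≡ g 0 → sumTo (λ d → g (suc d)) N ≡ sumTo g N
  rotate-once g zero _ = refl
  rotate-once g (suc N) gN≡g0 = begin
    sumTo (λ d → g (suc d)) N + g (suc N)  ≡⟨ cong (sumTo (λ d → g (suc d)) N +_) gN≡g0 ⟩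
    sumTo (λ d → g (suc d)) N + g 0        ≡⟨ +-comm _ (g 0) ⟩
    g 0 + sumTo (λ d → g (suc d)) N        ≡⟨ sym (sumTo-head g N) ⟩
    sumTo g (suc N)                        ∎

sumTo-𝟙-≡0 : ∀ (e : ℕ → Bool) l → sumTo (λ d → 𝟙 (e d)) l ≡ 0 → ∀ d → d < l → e d ≡ false
sumTo-𝟙-≡0 e (suc l) sum≡0 d d<l with m<1+n⇒m<n∨m≡n d<l
... | inj₁ d<l' = sumTo-𝟙-≡0 e l (m+n≡0⇒m≡0 _ sum≡0) d d<l'
... | inj₂ refl with e d | m+n≡0⇒n≡0 (sumTo (λ d → 𝟙 (e d)) l) sum≡0
...   | false | _ = refl

sumTo-𝟙-≡1 : ∀ (e : ℕ → Bool) l → sumTo (λ d → 𝟙 (e d)) l ≡ 1 →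
  Σ ℕ λ s → s < l × e s ≡ true × (∀ d → d < l → d ≢ s → e d ≡ false)
sumTo-𝟙-≡1 e (suc l) sum≡1 with e l in el
... | true = l , ≤-refl , el , others
  where
  others : ∀ d → d < suc l → d ≢ l → e d ≡ false
  others d d<sl d≢l with m<1+n⇒m<n∨m≡n d<sl
  ... | inj₁ d<l = sumTo-𝟙-≡0 e l (+-cancelʳ-≡ 1 _ 0 sum≡1) d d<l
  ... | inj₂ d≡l = ⊥-elim (d≢l d≡l)
... | false with sumTo-𝟙-≡1 e l (trans (sym (+-identityʳ _)) sum≡1)
... | s , s<l , es , others = s , m<n⇒m<1+n s<l , es , others′
  where
  others′ : ∀ d → d < suc l → d ≢ s → e d ≡ false
  others′ d d<sl d≢s with m<1+n⇒m<n∨m≡n d<sl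
  ... | inj₁ d<l = others d d<l d≢s
  ... | inj₂ refl = el

sumTo-𝟙-pos : ∀ (e : ℕ → Bool) l → 0 < sumTo (λ d → 𝟙 (e d)) l → Σ ℕ λ s → s < l × e s ≡ true
sumTo-𝟙-pos e (suc l) pos with e l in el
... | true = l , ≤-refl , el
... | false with sumTo-𝟙-pos e l (subst (0 <_) (+-identityʳ _) pos)
... | s , s<l , es = s , m<n⇒m<1+n s<l , es

sumTo-𝟙-point : ∀ p l → p < l → sumTo (λ d → 𝟙 (d ≡ᵇ p)) l ≡ 1
sumTo-𝟙-point p (suc l) p<sl with m<1+n⇒m<n∨m≡n p<sl
... | inj₁ p<l = cong₂ _+_ (sumTo-𝟙-point p l p<l) (cong 𝟙 (≢⇒≡ᵇ-false l p (>⇒≢ p<l)))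
... | inj₂ refl = begin
  sumTo (λ d → 𝟙 (d ≡ᵇ p)) p + 𝟙 (p ≡ᵇ p)   ≡⟨ cong₂ _+_ (sumTo-cong p (λ d d<p → cong 𝟙 (≢⇒≡ᵇ-false d p (<⇒≢ d<p)))) (cong 𝟙 (≡ᵇ-refl p)) ⟩
  sumTo (λ _ → 0) p + 1                      ≡⟨ cong (_+ 1) (sumTo-zero p) ⟩
  1                                          ∎
  where
  open ≡-Reasoning
  sumTo-zero : ∀ l → sumTo (λ _ → 0) l ≡ 0
  sumTo-zero zero = refl
  sumTo-zero (suc l) = trans (+-identityʳ _) (sumTo-zero l)

data Residue3 : ℕ → Set where
  +0 : ∀ q → Residue3 (q * 3)
  +1 : ∀ q → Residue3 (suc (q * 3))
  +2 : ∀ q → Residue3 (suc (suc (q * 3)))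

residue3 : ∀ y → Residue3 y
residue3 zero = +0 0
residue3 (suc y) with residue3 y
... | +0 q = +1 q
... | +1 q = +2 q
... | +2 q = +0 (suc q)

divMod3 : ∀ r q → r < 3 → (r + q * 3) / 3 ≡ q × (r + q * 3) % 3 ≡ r
divMod3 r q r<3 = trans (+-distrib-/-∣ʳ r (n∣m*n q)) (cong₂ _+_ (m<n⇒m/n≡0 r<3) (m*n/n≡m q 3))
                , trans ([m+kn]%n≡m%n r q 3) (m<n⇒m%n≡m r<3)

residue3-unique : ∀ r r′ q q′ → r < 3 → r′ < 3 → r + q * 3 ≡ r′ + q′ * 3 → r ≡ r′
residue3-unique r r′ q q′ r<3 r′<3 e = trans (sym (proj₂ (divMod3 _ q r<3))) (trans (cong (_% 3) e) (proj₂ (divMod3 _ q′ r′<3)))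

-- Subsets of C_n as n-periodic Boolean sequences

∈⇒lookup : ∀ {m} {x : Fin m} {X : Subset m} → x ∈ X → lookup X x ≡ true
∈⇒lookup = []=⇒lookup

lookup⇒∈ : ∀ {m} {x : Fin m} {X : Subset m} → lookup X x ≡ true → x ∈ X
lookup⇒∈ {x = x} {X} = lookup⇒[]= x X

∉⇒lookup : ∀ {m} {x : Fin m} {X : Subset m} → x ∉ X → lookup X x ≡ false
∉⇒lookup {x = x} {X} x∉X with lookup X x in e
... | true = ⊥-elim (x∉X (lookup⇒∈ e))
... | false = refl

lookup-─ : ∀ {m} (p q : Subset m) i → lookup (p ─ q) i ≡ (if lookup q i then false else lookup p i)
lookup-─ (a ∷ p) (true ∷ q) zero = refl
lookup-─ (a ∷ p) (false ∷ q) zero = refl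
lookup-─ (a ∷ p) (b ∷ q) (suc i) = lookup-─ p q i

lookup-∪ : ∀ {m} (p q : Subset m) i → lookup (p ∪ q) i ≡ (lookup p i ∨ lookup q i)
lookup-∪ (a ∷ p) (b ∷ q) zero = refl
lookup-∪ (a ∷ p) (b ∷ q) (suc i) = lookup-∪ p q i

lookup-ext : ∀ {m} (X Y : Subset m) → (∀ i → lookup X i ≡ lookup Y i) → X ≡ Y
lookup-ext X Y X≗Y = trans (sym (tabulate∘lookup X)) (trans (tabulate-cong X≗Y) (tabulate∘lookup Y))

-- Indexing by ℕ, false beyond the length.
_‼_ : ∀ {m} → Subset m → ℕ → Bool
[] ‼ _ = false
(b ∷ X) ‼ zero = b
(b ∷ X) ‼ suc d = X ‼ d

‼-toℕ : ∀ {m} (X : Subset m) (i : Fin m) → X ‼ toℕ i ≡ lookup X i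
‼-toℕ (b ∷ X) zero = refl
‼-toℕ (b ∷ X) (suc i) = ‼-toℕ X i

∣∣≡sumTo : ∀ {m} (X : Subset m) → ∣ X ∣ ≡ sumTo (λ d → 𝟙 (X ‼ d)) m
∣∣≡sumTo [] = refl
∣∣≡sumTo {suc m} (true ∷ X) = trans (cong suc (∣∣≡sumTo X)) (sym (sumTo-head (λ d → 𝟙 ((true ∷ X) ‼ d)) m))
∣∣≡sumTo {suc m} (false ∷ X) = trans (∣∣≡sumTo X) (sym (sumTo-head (λ d → 𝟙 ((false ∷ X) ‼ d)) m))

module Cycle (n : ℕ) .{{_ : NonZero n}} where

  %-absorbˡ : ∀ a b → (a % n + b) % n ≡ (a + b) % n
  %-absorbˡ a b = begin
    (a % n + b) % n          ≡⟨ %-distribˡ-+ (a % n) b n ⟩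
    (a % n % n + b % n) % n  ≡⟨ cong (λ z → (z + b % n) % n) (m%n%n≡m%n a n) ⟩
    (a % n + b % n) % n      ≡⟨ sym (%-distribˡ-+ a b n) ⟩
    (a + b) % n              ∎
    where open ≡-Reasoning

  %-absorbʳ : ∀ a b → (a + b % n) % n ≡ (a + b) % n
  %-absorbʳ a b = trans (cong (_% n) (+-comm a (b % n))) (trans (%-absorbˡ b a) (cong (_% n) (+-comm b a)))

  suc-% : ∀ a → suc (a % n) % n ≡ suc a % n
  suc-% a = trans (cong (_% n) (+-comm 1 (a % n))) (trans (%-absorbˡ a 1) (cong (_% n) (+-comm a 1)))

  %-absorb-*ˡ : ∀ a b → a % n * b % n ≡ a * b % n
  %-absorb-*ˡ a b = trans (%-distribˡ-* (a % n) b n) (trans (cong (λ z → z * (b % n) % n) (m%n%n≡m%n a n)) (sym (%-distribˡ-* a b n)))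

  suc-suc-% : ∀ a → suc (suc (a % n)) % n ≡ suc (suc a) % n
  suc-suc-% a = trans (sym (suc-% (suc (a % n)))) (trans (cong (λ z → suc z % n) (suc-% a)) (suc-% (suc a)))

  +-cancelˡ-% : ∀ a b c → (a + b) % n ≡ (a + c) % n → b % n ≡ c % n
  +-cancelˡ-% a b c ab≡ac = begin
    b % n                    ≡⟨ sym ([m+kn]%n≡m%n b a n) ⟩
    (b + a * n) % n          ≡⟨ cong (_% n) (reassoc b) ⟩
    (w + (a + b)) % n        ≡⟨ sym (%-absorbʳ w (a + b)) ⟩
    (w + (a + b) % n) % n    ≡⟨ cong (λ z → (w + z) % n) ab≡ac ⟩
    (w + (a + c) % n) % n    ≡⟨ %-absorbʳ w (a + c) ⟩
    (w + (a + c)) % n        ≡⟨ cong (_% n) (sym (reassoc c)) ⟩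
    (c + a * n) % n          ≡⟨ [m+kn]%n≡m%n c a n ⟩
    c % n                    ∎
    where
    open ≡-Reasoning
    w = a * n ∸ a
    reassoc : ∀ x → x + a * n ≡ w + (a + x)
    reassoc x = begin
      x + a * n        ≡⟨ cong (x +_) (sym (m∸n+n≡m (m≤m*n a n))) ⟩
      x + (w + a)      ≡⟨ +-comm x (w + a) ⟩
      (w + a) + x      ≡⟨ +-assoc w a x ⟩
      w + (a + x)      ∎

  ⟦_⟧ : ℕ → Fin n
  ⟦ d ⟧ = fromℕ< (m%n<n d n)

  toℕ-⟦⟧ : ∀ d → toℕ ⟦ d ⟧ ≡ d % n
  toℕ-⟦⟧ d = toℕ-fromℕ< (m%n<n d n)

  ⟦toℕ⟧ : ∀ (i : Fin n) → ⟦ toℕ i ⟧ ≡ i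
  ⟦toℕ⟧ i = toℕ-injective (trans (toℕ-⟦⟧ (toℕ i)) (m<n⇒m%n≡m (toℕ<n i)))

  SuccRel⇒≡ : ∀ {a b : Fin n} → SuccRel n a b → toℕ b ≡ suc (toℕ a) % n
  SuccRel⇒≡ {a} {b} (inj₁ e) = trans (sym e) (sym (m<n⇒m%n≡m (subst (_< n) (sym e) (toℕ<n b))))
  SuccRel⇒≡ (inj₂ (e₁ , e₂)) = trans e₂ (sym (trans (cong (_% n) e₁) (n%n≡0 n)))

  ≡⇒SuccRel : ∀ {a b : Fin n} → toℕ b ≡ suc (toℕ a) % n → SuccRel n a b
  ≡⇒SuccRel {a} e with m<1+n⇒m<n∨m≡n (s≤s (toℕ<n a))
  ... | inj₁ lt = inj₁ (sym (trans e (m<n⇒m%n≡m lt)))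
  ... | inj₂ eq = inj₂ (eq , trans e (trans (cong (_% n) eq) (n%n≡0 n)))

  CycleAdj-sym : ∀ {a b : Fin n} → CycleAdj n a b → CycleAdj n b a
  CycleAdj-sym (inj₁ p) = inj₂ p
  CycleAdj-sym (inj₂ p) = inj₁ p

  Periodic : (ℕ → Bool) → Set
  Periodic h = ∀ d → h (d + n) ≡ h d

  IndependentSeq : (ℕ → Bool) → Set
  IndependentSeq h = ∀ d → h d ≡ true → h (suc d) ≡ true → ⊥

  DominatingSeq : (ℕ → Bool) → Set
  DominatingSeq h = ∀ d → h d ≡ false → h (suc d) ≡ false → h (suc (suc d)) ≡ false → ⊥

  periodic-+* : ∀ {h} → Periodic h → ∀ x q → h (x + q * n) ≡ h x
  periodic-+* {h} per x zero = cong h (+-identityʳ x)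
  periodic-+* {h} per x (suc q) = begin
    h (x + (n + q * n))   ≡⟨ cong h (trans (cong (x +_) (+-comm n (q * n))) (sym (+-assoc x (q * n) n))) ⟩
    h (x + q * n + n)     ≡⟨ per (x + q * n) ⟩
    h (x + q * n)         ≡⟨ periodic-+* per x q ⟩
    h x                   ∎
    where open ≡-Reasoning

  periodic-% : ∀ {h} → Periodic h → ∀ d → h (d % n) ≡ h d
  periodic-% {h} per d = trans (sym (periodic-+* per (d % n) (d / n))) (cong h (sym (m≡m%n+[m/n]*n d n)))

  seqOf : Subset n → ℕ → Bool
  seqOf X d = X ‼ (d % n)

  seqOf-lookup : ∀ X d → seqOf X d ≡ lookup X ⟦ d ⟧
  seqOf-lookup X d = trans (cong (X ‼_) (sym (toℕ-⟦⟧ d))) (‼-toℕ X ⟦ d ⟧)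

  seqOf-periodic : ∀ X → Periodic (seqOf X)
  seqOf-periodic X d = cong (X ‼_) ([m+n]%n≡m%n d n)

  weight : (ℕ → Bool) → ℕ
  weight h = sumTo (λ d → 𝟙 (h d)) n

  ∣∣≡weight : ∀ X → ∣ X ∣ ≡ weight (seqOf X)
  ∣∣≡weight X = trans (∣∣≡sumTo X) (sumTo-cong n (λ d d<n → cong (λ z → 𝟙 (X ‼ z)) (sym (m<n⇒m%n≡m d<n))))

  subsetOf : (ℕ → Bool) → Subset n
  subsetOf h = tabulate (λ i → h (toℕ i))

  lookup-subsetOf : ∀ h i → lookup (subsetOf h) i ≡ h (toℕ i)
  lookup-subsetOf h i = lookup∘tabulate (λ i → h (toℕ i)) i

  seqOf-subsetOf : ∀ {h} → Periodic h → ∀ d → seqOf (subsetOf h) d ≡ h d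
  seqOf-subsetOf {h} per d = begin
    seqOf (subsetOf h) d          ≡⟨ seqOf-lookup (subsetOf h) d ⟩
    lookup (subsetOf h) ⟦ d ⟧     ≡⟨ lookup-subsetOf h ⟦ d ⟧ ⟩
    h (toℕ ⟦ d ⟧)                 ≡⟨ cong h (toℕ-⟦⟧ d) ⟩
    h (d % n)                     ≡⟨ periodic-% per d ⟩
    h d                           ∎
    where open ≡-Reasoning

  subsetOf-cong : ∀ h h′ → (∀ d → d < n → h d ≡ h′ d) → subsetOf h ≡ subsetOf h′
  subsetOf-cong h h′ h≡h′ = tabulate-cong (λ i → h≡h′ (toℕ i) (toℕ<n i))

  subsetOf-seqOf : ∀ X → subsetOf (seqOf X) ≡ X
  subsetOf-seqOf X = lookup-ext _ _ λ i → begin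
    lookup (subsetOf (seqOf X)) i   ≡⟨ lookup-subsetOf (seqOf X) i ⟩
    seqOf X (toℕ i)                 ≡⟨ seqOf-lookup X (toℕ i) ⟩
    lookup X ⟦ toℕ i ⟧              ≡⟨ cong (lookup X) (⟦toℕ⟧ i) ⟩
    lookup X i                      ∎
    where open ≡-Reasoning

  module _ (X : Subset n) (ids : IndepDominating (CycleAdj n) X) where

    indepDominating⇒independentSeq : IndependentSeq (seqOf X)
    indepDominating⇒independentSeq d Xd Xsd = proj₁ ids ⟦ d ⟧ ⟦ suc d ⟧
      (lookup⇒∈ (trans (sym (seqOf-lookup X d)) Xd)) (lookup⇒∈ (trans (sym (seqOf-lookup X (suc d))) Xsd))
      (inj₁ (≡⇒SuccRel (trans (toℕ-⟦⟧ (suc d)) (trans (sym (suc-% d)) (cong (λ z → suc z % n) (sym (toℕ-⟦⟧ d)))))))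

    indepDominating⇒dominatingSeq : DominatingSeq (seqOf X)
    indepDominating⇒dominatingSeq d Xd Xsd Xssd with proj₂ ids ⟦ suc d ⟧
    ... | inj₁ sd∈X = true≢false (trans (sym (∈⇒lookup sd∈X)) (trans (sym (seqOf-lookup X (suc d))) Xsd))
    ... | inj₂ (u , u∈X , inj₁ u→sd) = true≢false (trans (sym (∈⇒lookup u∈X)) (trans (cong (lookup X) u≡d) (trans (sym (seqOf-lookup X d)) Xd)))
      where
      u≡d : u ≡ ⟦ d ⟧
      u≡d = toℕ-injective (trans (sym (m<n⇒m%n≡m (toℕ<n u)))
              (trans (+-cancelˡ-% 1 (toℕ u) d (trans (sym (SuccRel⇒≡ u→sd)) (toℕ-⟦⟧ (suc d)))) (sym (toℕ-⟦⟧ d))))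
    ... | inj₂ (u , u∈X , inj₂ sd→u) = true≢false (trans (sym (∈⇒lookup u∈X)) (trans (cong (lookup X) u≡ssd) (trans (sym (seqOf-lookup X (suc (suc d)))) Xssd)))
      where
      u≡ssd : u ≡ ⟦ suc (suc d) ⟧
      u≡ssd = toℕ-injective (trans (SuccRel⇒≡ sd→u) (trans (cong (λ z → suc z % n) (toℕ-⟦⟧ (suc d)))
                (trans (suc-% (suc d)) (sym (toℕ-⟦⟧ (suc (suc d)))))))

  module _ {h : ℕ → Bool} (per : Periodic h) (indep : IndependentSeq h) (dom : DominatingSeq h) where

    seqRules⇒indepDominating : IndepDominating (CycleAdj n) (subsetOf h)
    seqRules⇒indepDominating = independent , dominating
      where
      member : ∀ {x} → x ∈ subsetOf h → h (toℕ x) ≡ true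
      member {x} x∈ = trans (sym (lookup-subsetOf h x)) (∈⇒lookup x∈)
      next : ∀ {x y} → SuccRel n x y → y ∈ subsetOf h → h (suc (toℕ x)) ≡ true
      next {x} x→y y∈ = trans (sym (periodic-% per (suc (toℕ x)))) (trans (cong h (sym (SuccRel⇒≡ x→y))) (member y∈))
      independent : Independent (CycleAdj n) (subsetOf h)
      independent x y x∈ y∈ (inj₁ x→y) = indep (toℕ x) (member x∈) (next x→y y∈)
      independent x y x∈ y∈ (inj₂ y→x) = indep (toℕ y) (member y∈) (next y→x x∈)
      pred+suc : ∀ a → suc (a + pred n) ≡ a + n
      pred+suc a = trans (sym (+-suc a (pred n))) (cong (a +_) (suc-pred n))
      dominating : Dominating (CycleAdj n) (subsetOf h)
      dominating v with h (toℕ v) in hv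
      ... | true = inj₁ (lookup⇒∈ (trans (lookup-subsetOf h v) hv))
      ... | false with h (suc (toℕ v)) in hs
      ...   | true = inj₂ (⟦ suc (toℕ v) ⟧ , lookup⇒∈ (trans (lookup-subsetOf h _) (trans (cong h (toℕ-⟦⟧ _)) (trans (periodic-% per _) hs)))
                          , inj₂ (≡⇒SuccRel (toℕ-⟦⟧ _)))
      ...   | false with h (toℕ v + pred n) in hp
      ...     | true = inj₂ (⟦ toℕ v + pred n ⟧ , lookup⇒∈ (trans (lookup-subsetOf h _) (trans (cong h (toℕ-⟦⟧ _)) (trans (periodic-% per _) hp)))
                          , inj₁ (≡⇒SuccRel (sym pred→v)))
        where
        pred→v : suc (toℕ ⟦ toℕ v + pred n ⟧) % n ≡ toℕ v
        pred→v = trans (cong (λ z → suc z % n) (toℕ-⟦⟧ _)) (trans (suc-% _)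
                   (trans (cong (_% n) (pred+suc _)) (trans ([m+n]%n≡m%n _ n) (m<n⇒m%n≡m (toℕ<n v)))))
      ...     | false = ⊥-elim (dom _ hp (trans (cong h (pred+suc _)) (trans (per _) hv))
                          (trans (cong h (cong suc (pred+suc _))) (trans (per _) hs)))

  record Slide (h h′ : ℕ → Bool) (x y : Fin n) : Set where
    field
      adjacent : CycleAdj n x y
      x-before : h (toℕ x) ≡ true
      y-before : h (toℕ y) ≡ false
      y-after : h′ (toℕ y) ≡ true
      x-after : h′ (toℕ x) ≡ false
      unchanged : ∀ i → i ≢ x → i ≢ y → h′ (toℕ i) ≡ h (toℕ i)

  Slide-reverse : ∀ {h h′ x y} → Slide h h′ x y → Slide h′ h y x
  Slide-reverse s = record
    { adjacent = CycleAdj-sym adjacent ; x-before = y-after ; y-before = x-after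
    ; y-after = x-before ; x-after = y-before ; unchanged = λ i i≢y i≢x → sym (unchanged i i≢x i≢y) }
    where open Slide s

  Slide⇒IAdj : ∀ {h h′ x y} → Slide h h′ x y → IAdj (CycleAdj n) (subsetOf h) (subsetOf h′)
  Slide⇒IAdj {h} {h′} {x} {y} s = x , y , adjacent , lookup⇒∈ (trans (lookup-subsetOf h x) x-before)
    , (λ y∈ → true≢false (trans (sym (∈⇒lookup y∈)) (trans (lookup-subsetOf h y) y-before))) , lookup-ext _ _ pointwise
    where
    open Slide s
    pointwise : ∀ i → lookup (subsetOf h′) i ≡ lookup ((subsetOf h ─ ⁅ x ⁆) ∪ ⁅ y ⁆) i
    pointwise i rewrite lookup-∪ (subsetOf h ─ ⁅ x ⁆) ⁅ y ⁆ i | lookup-─ (subsetOf h) ⁅ x ⁆ i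
                      | lookup-subsetOf h′ i | lookup-subsetOf h i with i ≟ᶠ x | i ≟ᶠ y
    ... | yes refl | _ rewrite ∈⇒lookup (x∈⁅x⁆ i)
                             | ∉⇒lookup (x≢y⇒x∉⁅y⁆ (λ i≡y → true≢false (trans (sym x-before) (trans (cong (λ z → h (toℕ z)) i≡y) y-before))))
                             = x-after
    ... | no i≢x | yes refl rewrite ∉⇒lookup (x≢y⇒x∉⁅y⁆ i≢x) | ∈⇒lookup (x∈⁅x⁆ i) = trans y-after (sym (∨-zeroʳ (h (toℕ i))))
    ... | no i≢x | no i≢y rewrite ∉⇒lookup (x≢y⇒x∉⁅y⁆ i≢x) | ∉⇒lookup (x≢y⇒x∉⁅y⁆ i≢y) =
      trans (unchanged i i≢x i≢y) (sym (∨-identityʳ _))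

  rotate : (ℕ → Bool) → ℕ → ℕ → Bool
  rotate P c i = P ((i + c) % n)

  rotate-periodic : ∀ P c → Periodic (rotate P c)
  rotate-periodic P c i = cong P (trans (cong (_% n) swap) ([m+n]%n≡m%n (i + c) n))
    where
    swap : i + n + c ≡ i + c + n
    swap = trans (+-assoc i n c) (trans (cong (i +_) (+-comm n c)) (sym (+-assoc i c n)))

  unrotate : ℕ → ℕ → Fin n
  unrotate c d = ⟦ d + (n ∸ c % n) ⟧

  +-∸%+-% : ∀ c d → (d + ((n ∸ c % n) + c)) % n ≡ d % n
  +-∸%+-% c d = trans (cong (λ z → (d + z) % n) full-turn) ([m+kn]%n≡m%n d (suc (c / n)) n)
    where
    open ≡-Reasoning
    full-turn : (n ∸ c % n) + c ≡ suc (c / n) * n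
    full-turn = begin
      (n ∸ c % n) + c                    ≡⟨ cong ((n ∸ c % n) +_) (m≡m%n+[m/n]*n c n) ⟩
      (n ∸ c % n) + (c % n + c / n * n)  ≡⟨ sym (+-assoc (n ∸ c % n) _ _) ⟩
      (n ∸ c % n) + c % n + c / n * n    ≡⟨ cong (_+ c / n * n) (m∸n+n≡m (m%n≤n c n)) ⟩
      n + c / n * n                      ∎

  rotate-unrotate : ∀ c d → d < n → (toℕ (unrotate c d) + c) % n ≡ d
  rotate-unrotate c d d<n = begin
    (toℕ (unrotate c d) + c) % n           ≡⟨ cong (λ z → (z + c) % n) (toℕ-⟦⟧ _) ⟩
    ((d + (n ∸ c % n)) % n + c) % n        ≡⟨ %-absorbˡ (d + (n ∸ c % n)) c ⟩
    (d + (n ∸ c % n) + c) % n              ≡⟨ cong (_% n) (+-assoc d _ c) ⟩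
    (d + ((n ∸ c % n) + c)) % n            ≡⟨ +-∸%+-% c d ⟩
    d % n                                  ≡⟨ m<n⇒m%n≡m d<n ⟩
    d                                      ∎
    where open ≡-Reasoning

  unrotate-unique : ∀ c i d → i < n → (i + c) % n ≡ d → toℕ (unrotate c d) ≡ i
  unrotate-unique c i d i<n i+c≡d = begin
    toℕ (unrotate c d)                     ≡⟨ toℕ-⟦⟧ _ ⟩
    (d + (n ∸ c % n)) % n                  ≡⟨ cong (λ z → (z + (n ∸ c % n)) % n) (sym i+c≡d) ⟩
    ((i + c) % n + (n ∸ c % n)) % n        ≡⟨ %-absorbˡ (i + c) _ ⟩
    (i + c + (n ∸ c % n)) % n              ≡⟨ cong (_% n) (trans (+-assoc i c _) (cong (i +_) (+-comm c _))) ⟩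
    (i + ((n ∸ c % n) + c)) % n            ≡⟨ +-∸%+-% c i ⟩
    i % n                                  ≡⟨ m<n⇒m%n≡m i<n ⟩
    i                                      ∎
    where open ≡-Reasoning

  -- A slide from dx to its predecessor dy, described in the window [0, n), whose result is P′ rotated by δ.
  record WindowSlide (P P′ : ℕ → Bool) (δ dx dy : ℕ) : Set where
    field
      dx<n : dx < n
      dy<n : dy < n
      dy→dx : suc dy % n ≡ dx
      dx-before : P dx ≡ true
      dy-before : P dy ≡ false
      dy-after : P′ ((dy + δ) % n) ≡ true
      dx-after : P′ ((dx + δ) % n) ≡ false
      unchanged : ∀ d → d < n → d ≢ dx → d ≢ dy → P′ ((d + δ) % n) ≡ P d

  WindowSlide⇒Slide : ∀ {P P′ δ dx dy} → WindowSlide P P′ δ dx dy → ∀ c c′ → c′ % n ≡ (c + δ) % n →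
    Slide (rotate P c) (rotate P′ c′) (unrotate c dx) (unrotate c dy)
  WindowSlide⇒Slide {P} {P′} {δ} {dx} {dy} s c c′ c′≡c+δ = record
    { adjacent = inj₂ (≡⇒SuccRel dy→dx′)
    ; x-before = trans (cong P (rotate-unrotate c dx dx<n)) dx-before
    ; y-before = trans (cong P (rotate-unrotate c dy dy<n)) dy-before
    ; y-after = trans (cong P′ (trans (shift _) (cong (λ z → (z + δ) % n) (rotate-unrotate c dy dy<n)))) dy-after
    ; x-after = trans (cong P′ (trans (shift _) (cong (λ z → (z + δ) % n) (rotate-unrotate c dx dx<n)))) dx-after
    ; unchanged = λ i i≢x i≢y → trans (cong P′ (shift (toℕ i)))
        (unchanged ((toℕ i + c) % n) (m%n<n _ n)
          (λ e → i≢x (toℕ-injective (sym (unrotate-unique c (toℕ i) dx (toℕ<n i) e))))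
          (λ e → i≢y (toℕ-injective (sym (unrotate-unique c (toℕ i) dy (toℕ<n i) e)))))
    }
    where
    open WindowSlide s
    open ≡-Reasoning
    shift : ∀ i → (i + c′) % n ≡ ((i + c) % n + δ) % n
    shift i = begin
      (i + c′) % n             ≡⟨ sym (%-absorbʳ i c′) ⟩
      (i + c′ % n) % n         ≡⟨ cong (λ z → (i + z) % n) c′≡c+δ ⟩
      (i + (c + δ) % n) % n    ≡⟨ %-absorbʳ i (c + δ) ⟩
      (i + (c + δ)) % n        ≡⟨ cong (_% n) (sym (+-assoc i c δ)) ⟩
      (i + c + δ) % n          ≡⟨ sym (%-absorbˡ (i + c) δ) ⟩
      ((i + c) % n + δ) % n    ∎
    dy→dx′ : toℕ (unrotate c dx) ≡ suc (toℕ (unrotate c dy)) % n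
    dy→dx′ = begin
      toℕ (unrotate c dx)                    ≡⟨ toℕ-⟦⟧ _ ⟩
      (dx + (n ∸ c % n)) % n                 ≡⟨ cong (λ z → (z + (n ∸ c % n)) % n) (sym dy→dx) ⟩
      (suc dy % n + (n ∸ c % n)) % n         ≡⟨ %-absorbˡ (suc dy) _ ⟩
      (suc dy + (n ∸ c % n)) % n             ≡⟨ sym (suc-% (dy + (n ∸ c % n))) ⟩
      suc ((dy + (n ∸ c % n)) % n) % n       ≡⟨ cong (λ z → suc z % n) (sym (toℕ-⟦⟧ _)) ⟩
      suc (toℕ (unrotate c dy)) % n          ∎

  -- Under IndependentSeq, a gap of length two starting at d.
  gap₂ : (ℕ → Bool) → ℕ → Bool
  gap₂ h d = h d ∧ h (suc (suc d))

  gap₂-periodic : ∀ {h} → Periodic h → Periodic (gap₂ h)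
  gap₂-periodic per d = cong₂ _∧_ (per d) (per (suc (suc d)))

  gap₂-recurrence : ∀ {h} → IndependentSeq h → DominatingSeq h → ∀ d →
    h (suc (suc d)) ≡ (if h (suc d) then false else (if h d then gap₂ h d else true))
  gap₂-recurrence {h} indep dom d with h (suc d) in e₁ | h d in e₀ | h (suc (suc d)) in e₂
  ... | true  | _     | true  = ⊥-elim (indep (suc d) e₁ e₂)
  ... | true  | _     | false = refl
  ... | false | true  | _     = refl
  ... | false | false | true  = refl
  ... | false | false | false = ⊥-elim (dom d e₀ e₁ e₂)

  gap₂-rigid₀ : ∀ {f g} → IndependentSeq f → DominatingSeq f → IndependentSeq g → DominatingSeq g →
    f 0 ≡ true → g 0 ≡ true → (∀ s → gap₂ f s ≡ gap₂ g s) → ∀ s → f s ≡ g s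
  gap₂-rigid₀ {f} {g} f-indep f-dom g-indep g-dom f0 g0 same-gaps s = proj₁ (agree s)
    where
    after-token : ∀ {h} → IndependentSeq h → h 0 ≡ true → h 1 ≡ false
    after-token {h} indep h0 with h 1 in e
    ... | true = ⊥-elim (indep 0 h0 e)
    ... | false = refl
    agree : ∀ s → f s ≡ g s × f (suc s) ≡ g (suc s)
    agree zero = trans f0 (sym g0) , trans (after-token f-indep f0) (sym (after-token g-indep g0))
    agree (suc s) with agree s
    ... | fs≡gs , fss≡gss = fss≡gss , (begin
      f (suc (suc s))                                                    ≡⟨ gap₂-recurrence f-indep f-dom s ⟩
      (if f (suc s) then false else (if f s then gap₂ f s else true))    ≡⟨ cong₂ (λ a b → if a then false else (if b then gap₂ f s else true)) fss≡gss fs≡gs ⟩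
      (if g (suc s) then false else (if g s then gap₂ f s else true))    ≡⟨ cong (λ z → if g (suc s) then false else (if g s then z else true)) (same-gaps s) ⟩
      (if g (suc s) then false else (if g s then gap₂ g s else true))    ≡⟨ sym (gap₂-recurrence g-indep g-dom s) ⟩
      g (suc (suc s))                                                    ∎)
      where open ≡-Reasoning

  shift : (ℕ → Bool) → ℕ → ℕ → Bool
  shift h a s = h (a + s)

  shift-periodic : ∀ {h} a → Periodic h → Periodic (shift h a)
  shift-periodic {h} a per d = trans (cong h (sym (+-assoc a d n))) (per (a + d))

  IndependentSeq-shift : ∀ {h} a → IndependentSeq h → IndependentSeq (shift h a)
  IndependentSeq-shift {h} a indep s has hasuc = indep (a + s) has (trans (cong h (sym (+-suc a s))) hasuc)

  DominatingSeq-shift : ∀ {h} a → DominatingSeq h → DominatingSeq (shift h a)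
  DominatingSeq-shift {h} a dom s has hasuc hassuc = dom (a + s) has (trans (cong h (sym (+-suc a s)))  hasuc)
    (trans (cong h (sym (trans (+-suc a (suc s)) (cong suc (+-suc a s))))) hassuc)

  gap₂-shift : ∀ h a s → gap₂ (shift h a) s ≡ gap₂ h (a + s)
  gap₂-shift h a s = cong (λ z → h (a + s) ∧ z) (cong h (trans (+-suc a (suc s)) (cong suc (+-suc a s))))

  gap₂-rigid : ∀ {f g} → IndependentSeq f → DominatingSeq f → IndependentSeq g → DominatingSeq g →
    ∀ a → f a ≡ true → g a ≡ true → (∀ s → gap₂ f (a + s) ≡ gap₂ g (a + s)) → ∀ s → f (a + s) ≡ g (a + s)
  gap₂-rigid {f} {g} f-indep f-dom g-indep g-dom a fa ga same-gaps =
    gap₂-rigid₀ (IndependentSeq-shift a f-indep) (DominatingSeq-shift a f-dom)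
      (IndependentSeq-shift a g-indep) (DominatingSeq-shift a g-dom)
      (trans (cong f (+-identityʳ a)) fa) (trans (cong g (+-identityʳ a)) ga)
      (λ s → trans (gap₂-shift f a s) (trans (same-gaps s) (sym (gap₂-shift g a s))))

  window : (ℕ → Bool) → ℕ → ℕ
  window h d = 𝟙 (h d) + 𝟙 (h (suc d)) + 𝟙 (h (suc (suc d)))

  window≡1+gap₂ : ∀ {h} → IndependentSeq h → DominatingSeq h → ∀ d → window h d ≡ suc (𝟙 (gap₂ h d))
  window≡1+gap₂ {h} indep dom d with h d in e₀ | h (suc d) in e₁ | h (suc (suc d)) in e₂
  ... | true  | true  | _     = ⊥-elim (indep d e₀ e₁)
  ... | _     | true  | true  = ⊥-elim (indep (suc d) e₁ e₂)
  ... | true  | false | true  = refl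
  ... | true  | false | false = refl
  ... | false | true  | false = refl
  ... | false | false | true  = refl
  ... | false | false | false = ⊥-elim (dom d e₀ e₁ e₂)

  window≥1 : ∀ {h} → DominatingSeq h → ∀ d → 1 ≤ window h d
  window≥1 {h} dom d with h d in e₀ | h (suc d) in e₁ | h (suc (suc d)) in e₂
  ... | true  | _     | _     = s≤s z≤n
  ... | false | true  | _     = s≤s z≤n
  ... | false | false | true  = s≤s z≤n
  ... | false | false | false = ⊥-elim (dom d e₀ e₁ e₂)

  -- Each token lies in exactly three windows.
  sumTo-window : ∀ {h} → Periodic h → sumTo (window h) n ≡ weight h + weight h + weight h
  sumTo-window {h} per = begin
    sumTo (window h) n
      ≡⟨ sumTo-+ (λ d → 𝟙 (h d) + 𝟙 (h (suc d))) (λ d → 𝟙 (h (suc (suc d)))) n ⟩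
    sumTo (λ d → 𝟙 (h d) + 𝟙 (h (suc d))) n + sumTo (λ d → 𝟙 (h (suc (suc d)))) n
      ≡⟨ cong₂ _+_ (sumTo-+ (λ d → 𝟙 (h d)) (λ d → 𝟙 (h (suc d))) n) (sumTo-rotate f n per-f 2) ⟩
    weight h + sumTo (λ d → 𝟙 (h (suc d))) n + weight h
      ≡⟨ cong (λ z → weight h + z + weight h) (sumTo-rotate f n per-f 1) ⟩
    weight h + weight h + weight h
      ∎
    where
    open ≡-Reasoning
    f = λ d → 𝟙 (h d)
    per-f : ∀ d → f (d + n) ≡ f d
    per-f d = cong 𝟙 (per d)

  n≤3*weight : ∀ {h} → Periodic h → DominatingSeq h → n ≤ weight h + weight h + weight h
  n≤3*weight per dom = subst₂ _≤_ (sumTo-const-1 n) (sumTo-window per) (sumTo-mono-≤ n (λ d _ → window≥1 dom d))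

  3*weight≡n+gaps : ∀ {h} → Periodic h → IndependentSeq h → DominatingSeq h →
    weight h + weight h + weight h ≡ n + weight (gap₂ h)
  3*weight≡n+gaps {h} per indep dom = begin
    weight h + weight h + weight h              ≡⟨ sym (sumTo-window per) ⟩
    sumTo (window h) n                          ≡⟨ sumTo-cong n (λ d _ → window≡1+gap₂ indep dom d) ⟩
    sumTo (λ d → 1 + 𝟙 (gap₂ h d)) n            ≡⟨ sumTo-+ (λ _ → 1) (λ d → 𝟙 (gap₂ h d)) n ⟩
    sumTo (λ _ → 1) n + weight (gap₂ h)         ≡⟨ cong (_+ weight (gap₂ h)) (sumTo-const-1 n) ⟩
    n + weight (gap₂ h)                         ∎
    where open ≡-Reasoning

  after-3-gap : ∀ {f} → IndependentSeq f → DominatingSeq f → ∀ x → f x ≡ true → gap₂ f x ≡ false →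
    f (suc x) ≡ false × f (suc (suc x)) ≡ false × f (3 + x) ≡ true
  after-3-gap {f} indep dom x fx no-gap = f1 , f2 , f3
    where
    f1 : f (suc x) ≡ false
    f1 with f (suc x) in e
    ... | true = ⊥-elim (indep x fx e)
    ... | false = refl
    f2 : f (suc (suc x)) ≡ false
    f2 = trans (sym (cong (_∧ f (suc (suc x))) fx)) no-gap
    f3 : f (3 + x) ≡ true
    f3 with f (3 + x) in e
    ... | true = refl
    ... | false = ⊥-elim (dom (suc x) f1 f2 e)

  tokens-every-3 : ∀ {f} → IndependentSeq f → DominatingSeq f → ∀ c j → f c ≡ true →
    (∀ i → i < j → gap₂ f (c + i * 3) ≡ false) → f (c + j * 3) ≡ true
  tokens-every-3 {f} indep dom c zero fc _ = trans (cong f (+-identityʳ c)) fc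
  tokens-every-3 {f} indep dom c (suc j) fc no-gaps = trans (cong f c+3+3j) (proj₂ (proj₂ (after-3-gap indep dom _
    (tokens-every-3 indep dom c j fc (λ i i<j → no-gaps i (m<n⇒m<1+n i<j))) (no-gaps j ≤-refl))))
    where
    c+3+3j : c + suc j * 3 ≡ 3 + (c + j * 3)
    c+3+3j = trans (+-suc c _) (cong suc (trans (+-suc c _) (cong suc (+-suc c (j * 3)))))

  free-after-run : ∀ {f} → IndependentSeq f → DominatingSeq f → ∀ x j → f x ≡ true →
    (∀ i → i ≤ j → gap₂ f (x + i * 3) ≡ false) → f (suc (x + j * 3)) ≡ false × f (suc (suc (x + j * 3))) ≡ false
  free-after-run indep dom x j fx no-gaps with after-3-gap indep dom (x + j * 3)
    (tokens-every-3 indep dom x j fx (λ i i<j → no-gaps i (<⇒≤ i<j))) (no-gaps j ≤-refl)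
  ... | f1 , f2 , _ = f1 , f2

  no-gap₂⇒distance≡3j : ∀ {f} → IndependentSeq f → DominatingSeq f → ∀ x y → x ≤ y → f x ≡ true → f y ≡ true →
    (∀ s → x ≤ s → s < y → gap₂ f s ≡ false) → ∃ λ j → y ≡ x + j * 3
  no-gap₂⇒distance≡3j {f} indep dom x y x≤y fx fy no-gaps with m≤n⇒∃[o]m+o≡n x≤y
  ... | d , refl with residue3 d
  ...   | +0 j = j , refl
  ...   | +1 j = ⊥-elim (true≢false (trans (sym fy) (trans (cong f (+-suc x (j * 3)))
                   (proj₁ (free-after-run indep dom x j fx (λ i i≤j → no-gaps _ (m≤m+n x _) (+-monoʳ-< x (s≤s (*-monoˡ-≤ 3 i≤j)))))))))
  ...   | +2 j = ⊥-elim (true≢false (trans (sym fy) (trans (cong f (trans (+-suc x (suc (j * 3))) (cong suc (+-suc x (j * 3)))))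
                   (proj₂ (free-after-run indep dom x j fx (λ i i≤j → no-gaps _ (m≤m+n x _)
                     (+-monoʳ-< x (s≤s (≤-trans (*-monoˡ-≤ 3 i≤j) (n≤1+n _))))))))))

-- The canonical i-sets

zeroOr : ℕ → ℕ → Bool
zeroOr p y = (y ≡ᵇ 0) ∨ (y ≡ᵇ p)

zeroOr-true : ∀ p y → zeroOr p y ≡ true → y ≡ 0 ⊎ y ≡ p
zeroOr-true p y e with y ≡ᵇ 0 in y≡ᵇ0
... | true = inj₁ (≡ᵇ-true⇒≡ y 0 y≡ᵇ0)
... | false = inj₂ (≡ᵇ-true⇒≡ y p e)

sumTo-𝟙-zeroOr : ∀ p l → p ≢ 0 → p < l → sumTo (λ d → 𝟙 (zeroOr p d)) l ≡ 2
sumTo-𝟙-zeroOr p l p≢0 p<l = begin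
  sumTo (λ d → 𝟙 (zeroOr p d)) l                            ≡⟨ sumTo-cong l (λ d _ → split d) ⟩
  sumTo (λ d → 𝟙 (d ≡ᵇ 0) + 𝟙 (d ≡ᵇ p)) l                    ≡⟨ sumTo-+ (λ d → 𝟙 (d ≡ᵇ 0)) (λ d → 𝟙 (d ≡ᵇ p)) l ⟩
  sumTo (λ d → 𝟙 (d ≡ᵇ 0)) l + sumTo (λ d → 𝟙 (d ≡ᵇ p)) l    ≡⟨ cong₂ _+_ (sumTo-𝟙-point 0 l (≤-<-trans z≤n p<l)) (sumTo-𝟙-point p l p<l) ⟩
  2                                                         ∎
  where
  open ≡-Reasoning
  split : ∀ d → 𝟙 (zeroOr p d) ≡ 𝟙 (d ≡ᵇ 0) + 𝟙 (d ≡ᵇ p)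
  split d with d ≡ᵇ 0 in d≡ᵇ0
  ... | false = refl
  ... | true rewrite ≡ᵇ-true⇒≡ d 0 d≡ᵇ0 | ≢⇒≡ᵇ-false 0 p (p≢0 ∘ sym) = refl

-- canonical m has its tokens at 0, at 3q + 2 for q ≤ m and at 3q + 1 for q > m,
-- so that its 2-gaps start at 0 and at 3m + 2.
byResidue : ℕ → ℕ → ℕ → Bool
byResidue m q 0 = q ≡ᵇ 0
byResidue m q 1 = suc m ≤ᵇ q
byResidue m q 2 = q ≤ᵇ m
byResidue m q (suc (suc (suc _))) = false

canonical : ℕ → ℕ → Bool
canonical m d = byResidue m (d / 3) (d % 3)

canonical-+ : ∀ m r q → r < 3 → canonical m (r + q * 3) ≡ byResidue m q r
canonical-+ m r q r<3 = cong₂ (byResidue m) (proj₁ (divMod3 r q r<3)) (proj₂ (divMod3 r q r<3))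

canonical-0 : ∀ m q → canonical m (q * 3) ≡ (q ≡ᵇ 0)
canonical-0 m q = canonical-+ m 0 q (s≤s z≤n)

canonical-1 : ∀ m q → canonical m (suc (q * 3)) ≡ (suc m ≤ᵇ q)
canonical-1 m q = canonical-+ m 1 q (s≤s (s≤s z≤n))

canonical-2 : ∀ m q → canonical m (suc (suc (q * 3))) ≡ (q ≤ᵇ m)
canonical-2 m q = canonical-+ m 2 q ≤-refl

module Canonical (K : ℕ) where

  T : ℕ
  T = suc (suc (K * 2))

  n : ℕ
  n = suc (T * 3)

  open Cycle n public

  %-of-n : ∀ {x} → x ≡ n → x % n ≡ 0
  %-of-n refl = n%n≡0 n

  %-of-+n : ∀ {x} y → x ≡ y + n → y < n → x % n ≡ y
  %-of-+n y refl y<n = trans ([m+n]%n≡m%n y n) (m<n⇒m%n≡m y<n)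

  3q+3<n : ∀ {q} → q < T → suc q * 3 < n
  3q+3<n q<T = s≤s (*-monoˡ-≤ 3 q<T)

  3q+2<n : ∀ {q} → q < T → suc (suc (q * 3)) < n
  3q+2<n {q} q<T = ≤-trans (s≤s (s≤s (s≤s (n≤1+n (q * 3))))) (3q+3<n q<T)

  3q+1<n : ∀ {q} → q < T → suc (q * 3) < n
  3q+1<n q<T = ≤-trans (s≤s (n≤1+n _)) (3q+2<n q<T)

  3q<n : ∀ {q} → q ≤ T → q * 3 < n
  3q<n q≤T = s≤s (*-monoˡ-≤ 3 q≤T)

  K<T : K < T
  K<T = s≤s (≤-trans (m≤m*n K 2) (n≤1+n _))

  data Position : ℕ → Set where
    +0 : ∀ q → q ≤ T → Position (q * 3)
    +1 : ∀ q → q < T → Position (suc (q * 3))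
    +2 : ∀ q → q < T → Position (suc (suc (q * 3)))

  position : ∀ y → y < n → Position y
  position y y<n with residue3 y
  ... | +0 q = +0 q (*-cancelʳ-≤ q T 3 (s≤s⁻¹ y<n))
  ... | +1 q = +1 q (*-cancelʳ-< _ q T (s≤s⁻¹ y<n))
  ... | +2 q = +2 q (*-cancelʳ-< _ q T (≤-trans (n≤1+n _) (s≤s⁻¹ y<n)))

  last-or-not : ∀ {q} → q < T → suc q < T ⊎ suc q ≡ T
  last-or-not q<T = m<1+n⇒m<n∨m≡n (s≤s q<T)

  canonical-independent : ∀ m y → y < n → canonical m y ≡ true → canonical m (suc y % n) ≡ true → ⊥
  canonical-independent m y y<n now next with position y y<n
  ... | +0 zero _ = true≢false (trans (sym next) (cong (canonical m) (m<n⇒m%n≡m {n = n} (s≤s (s≤s z≤n)))))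
  ... | +0 (suc q) _ = true≢false (trans (sym now) (canonical-0 m (suc q)))
  ... | +1 q q<T = <-irrefl refl (≤-trans (≤ᵇ-true⇒≤ (suc m) q (trans (sym (canonical-1 m q)) now))
                     (≤ᵇ-true⇒≤ q m (trans (sym (canonical-2 m q)) (trans (cong (canonical m) (sym (m<n⇒m%n≡m (3q+2<n q<T)))) next))))
  ... | +2 q q<T = true≢false (trans (sym next) (trans (cong (canonical m) (m<n⇒m%n≡m (3q+3<n q<T))) (canonical-0 m (suc q))))

  canonical-dominating : ∀ m y → y < n → canonical m y ≡ false → canonical m (suc y % n) ≡ false →
    canonical m (suc (suc y) % n) ≡ false → ⊥
  canonical-dominating m y y<n now next next² with position y y<n
  ... | +0 zero _ = true≢false now
  ... | +0 (suc q) q+1≤T with m<1+n⇒m<n∨m≡n (s≤s q+1≤T)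
  ...   | inj₂ q+1≡T = true≢false (trans (cong (canonical m) (sym (%-of-n (cong (λ z → suc (z * 3)) q+1≡T)))) next)
  ...   | inj₁ q+1<T with suc q ≤? m
  ...     | yes q+1≤m = true≢false (trans (sym (≤⇒≤ᵇ-true q+1≤m))
                          (trans (sym (canonical-2 m (suc q))) (trans (cong (canonical m) (sym (m<n⇒m%n≡m (3q+2<n q+1<T)))) next²)))
  ...     | no q+1≰m = true≢false (trans (sym (≤⇒≤ᵇ-true (≰⇒> q+1≰m)))
                          (trans (sym (canonical-1 m (suc q))) (trans (cong (canonical m) (sym (m<n⇒m%n≡m (3q+1<n q+1<T)))) next)))
  canonical-dominating m y y<n now next next² | +1 q q<T with q ≤? m
  ... | yes q≤m = true≢false (trans (sym (≤⇒≤ᵇ-true q≤m))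
                    (trans (sym (canonical-2 m q)) (trans (cong (canonical m) (sym (m<n⇒m%n≡m (3q+2<n q<T)))) next)))
  ... | no q≰m = true≢false (trans (sym (≤⇒≤ᵇ-true (≰⇒> q≰m))) (trans (sym (canonical-1 m q)) now))
  canonical-dominating m y y<n now next next² | +2 q q<T with last-or-not q<T
  ... | inj₂ q+1≡T = true≢false (trans (cong (canonical m) (sym (%-of-n (cong (λ z → suc (z * 3)) q+1≡T)))) next²)
  ... | inj₁ q+1<T = true≢false (trans (sym (≤⇒≤ᵇ-true (s≤s m≤q)))
                       (trans (sym (canonical-1 m (suc q))) (trans (cong (canonical m) (sym (m<n⇒m%n≡m (3q+1<n q+1<T)))) next²)))
    where
    m≤q : m ≤ q
    m≤q with q ≤? m
    ... | yes q≤m = ⊥-elim (true≢false (trans (sym (≤⇒≤ᵇ-true q≤m)) (trans (sym (canonical-2 m q)) now)))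
    ... | no q≰m = <⇒≤ (≰⇒> q≰m)

  canonical-gap₂ : ∀ m → m ≤ K → ∀ y → y < n →
    (canonical m y ∧ canonical m (suc (suc y) % n)) ≡ zeroOr (suc (suc (m * 3))) y
  canonical-gap₂ m m≤K y y<n with position y y<n
  ... | +0 zero _ = cong (canonical m 0 ∧_) (cong (canonical m) (m<n⇒m%n≡m {n = n} (s≤s (s≤s (s≤s z≤n)))))
  ... | +0 (suc q) _ = trans (cong (_∧ canonical m (suc (suc (suc q * 3)) % n)) (canonical-0 m (suc q)))
                         (sym (≢⇒≡ᵇ-false (suc q * 3) (suc (suc (m * 3))) (λ e → 0≢1+n (residue3-unique 0 2 (suc q) m (s≤s z≤n) ≤-refl e))))
  ... | +1 q q<T = trans (cong (canonical m (suc (q * 3)) ∧_) (trans (cong (canonical m) (m<n⇒m%n≡m (3q+3<n q<T))) (canonical-0 m (suc q))))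
                     (trans (∧-zeroʳ _) (sym (≢⇒≡ᵇ-false (suc (q * 3)) (suc (suc (m * 3))) (λ e → 0≢1+n (suc-injective (residue3-unique 1 2 q m (s≤s (s≤s z≤n)) ≤-refl e))))))
  ... | +2 q q<T with last-or-not q<T
  ...   | inj₁ q+1<T = trans (cong₂ _∧_ (canonical-2 m q) (trans (cong (canonical m) (m<n⇒m%n≡m (3q+1<n q+1<T))) (trans (canonical-1 m (suc q)) (≤ᵇ-suc m q))))
                         (trans (≤ᵇ-antisym q m) (sym (≡ᵇ-*3 q m)))
  ...   | inj₂ q+1≡T = trans (cong₂ _∧_ (canonical-2 m q) (cong (canonical m) (%-of-n (cong (λ z → suc (z * 3)) q+1≡T))))
                         (trans (trans (cong (_∧ true) (>⇒≤ᵇ-false m<q)) refl)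
                           (sym (trans (≡ᵇ-*3 q m) (≢⇒≡ᵇ-false q m (>⇒≢ m<q)))))
    where
    m<q : m < q
    m<q = ≤-trans (s≤s m≤K) (≤-trans (s≤s (m≤m*n K 2)) (≤-reflexive (sym (suc-injective q+1≡T))))

  lowerSlide : ∀ m → suc m ≤ K → WindowSlide (canonical (suc m)) (canonical m) 0 (suc (suc (suc m * 3))) (suc (suc m * 3))
  lowerSlide m m+1≤K = record
    { dx<n = 3q+2<n m+1<T
    ; dy<n = 3q+1<n m+1<T
    ; dy→dx = m<n⇒m%n≡m (3q+2<n m+1<T)
    ; dx-before = trans (canonical-2 (suc m) (suc m)) (≤⇒≤ᵇ-true (≤-refl {suc m}))
    ; dy-before = trans (canonical-1 (suc m) (suc m)) (>⇒≤ᵇ-false (≤-refl {suc (suc m)}))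
    ; dy-after = trans (cong (canonical m) (+0-% (3q+1<n m+1<T))) (trans (canonical-1 m (suc m)) (≤⇒≤ᵇ-true (≤-refl {suc m})))
    ; dx-after = trans (cong (canonical m) (+0-% (3q+2<n m+1<T))) (trans (canonical-2 m (suc m)) (>⇒≤ᵇ-false (≤-refl {suc m})))
    ; unchanged = λ d d<n d≢x d≢y → trans (cong (canonical m) (+0-% d<n)) (elsewhere d d<n d≢x d≢y)
    }
    where
    m+1<T : suc m < T
    m+1<T = ≤-trans (s≤s m+1≤K) K<T
    +0-% : ∀ {d} → d < n → (d + 0) % n ≡ d
    +0-% {d} d<n = trans (cong (_% n) (+-identityʳ d)) (m<n⇒m%n≡m d<n)
    elsewhere : ∀ d → d < n → d ≢ suc (suc (suc m * 3)) → d ≢ suc (suc m * 3) → canonical m d ≡ canonical (suc m) d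
    elsewhere d d<n d≢x d≢y with position d d<n
    ... | +0 q _ = trans (canonical-0 m q) (sym (canonical-0 (suc m) q))
    ... | +1 q _ = trans (canonical-1 m q) (trans (≤ᵇ-skip m q (d≢y ∘ cong (λ z → suc (z * 3)))) (sym (canonical-1 (suc m) q)))
    ... | +2 q _ = trans (canonical-2 m q) (trans (≤ᵇ-skip′ m q (d≢x ∘ cong (λ z → suc (suc (z * 3))))) (sym (canonical-2 (suc m) q)))

  wrapSlide : ∀ m → suc m ≤ K → WindowSlide (canonical m) (canonical (suc m)) 3 0 (T * 3)
  wrapSlide m m+1≤K = record
    { dx<n = s≤s z≤n
    ; dy<n = ≤-refl
    ; dy→dx = %-of-n refl
    ; dx-before = refl
    ; dy-before = canonical-0 m T
    ; dy-after = cong (canonical (suc m)) (%-of-+n 2 (+-comm (T * 3) 3) (s≤s (s≤s (s≤s z≤n))))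
    ; dx-after = cong (canonical (suc m)) (m<n⇒m%n≡m {n = n} (s≤s (s≤s (s≤s (s≤s z≤n)))))
    ; unchanged = elsewhere
    }
    where
    m<T-1 : ∀ {q} → suc q ≡ T → m < q
    m<T-1 q+1≡T = ≤-trans (s≤s (≤-trans (n≤1+n m) m+1≤K)) (≤-trans (s≤s (m≤m*n K 2)) (≤-reflexive (sym (suc-injective q+1≡T))))
    elsewhere : ∀ d → d < n → d ≢ 0 → d ≢ T * 3 → canonical (suc m) ((d + 3) % n) ≡ canonical m d
    elsewhere d d<n d≢0 d≢3T with position d d<n
    ... | +0 zero _ = ⊥-elim (d≢0 refl)
    ... | +0 (suc q) q+1≤T with m<1+n⇒m<n∨m≡n (s≤s q+1≤T)
    ...   | inj₂ q+1≡T = ⊥-elim (d≢3T (cong (_* 3) q+1≡T))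
    ...   | inj₁ q+1<T = trans (cong (canonical (suc m)) (trans (cong (_% n) (+-comm (suc q * 3) 3)) (m<n⇒m%n≡m (3q+3<n q+1<T))))
                           (trans (canonical-0 (suc m) (suc (suc q))) (sym (canonical-0 m (suc q))))
    elsewhere d d<n d≢0 d≢3T | +1 q q<T with last-or-not q<T
    ... | inj₁ q+1<T = trans (cong (canonical (suc m)) (trans (cong (λ z → suc z % n) (+-comm (q * 3) 3)) (m<n⇒m%n≡m (3q+1<n q+1<T))))
                         (trans (canonical-1 (suc m) (suc q)) (trans (≤ᵇ-suc (suc m) q) (sym (canonical-1 m q))))
    ... | inj₂ q+1≡T = trans (cong (canonical (suc m)) (%-of-n (trans (cong suc (+-comm (q * 3) 3)) (cong (λ z → suc (z * 3)) q+1≡T))))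
                         (sym (trans (canonical-1 m q) (≤⇒≤ᵇ-true (m<T-1 q+1≡T))))
    elsewhere d d<n d≢0 d≢3T | +2 q q<T with last-or-not q<T
    ... | inj₁ q+1<T = trans (cong (canonical (suc m)) (trans (cong (λ z → suc (suc z) % n) (+-comm (q * 3) 3)) (m<n⇒m%n≡m (3q+2<n q+1<T))))
                         (trans (canonical-2 (suc m) (suc q)) (trans (≤ᵇ-suc q m) (sym (canonical-2 m q))))
    ... | inj₂ q+1≡T = trans (cong (canonical (suc m)) (%-of-+n 1 (trans (cong (λ z → suc (suc z)) (+-comm (q * 3) 3)) (cong (λ z → suc (suc (z * 3))) q+1≡T)) (s≤s (s≤s z≤n))))
                         (sym (trans (canonical-2 m q) (>⇒≤ᵇ-false (m<T-1 q+1≡T))))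

  -- In the top canonical set (m = K) the two 2-gaps are at distance 3K + 2 and 3K + 5, so moving
  -- the token at 0 back to n - 1 reproduces it, rotated by 3K + 5.
  topSlide : WindowSlide (canonical K) (canonical K) (suc (suc (suc K * 3))) 0 (T * 3)
  topSlide = record
    { dx<n = s≤s z≤n
    ; dy<n = ≤-refl
    ; dy→dx = %-of-n refl
    ; dx-before = refl
    ; dy-before = canonical-0 K T
    ; dy-after = trans (cong (canonical K) (%-of-+n (suc (suc K * 3)) (last+δ K) (3q+1<n K+1<T)))
                   (trans (canonical-1 K (suc K)) (≤⇒≤ᵇ-true (≤-refl {suc K})))
    ; dx-after = trans (cong (canonical K) (m<n⇒m%n≡m (3q+2<n K+1<T))) (trans (canonical-2 K (suc K)) (>⇒≤ᵇ-false (≤-refl {suc K})))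
    ; unchanged = elsewhere
    }
    where
    δ = suc (suc (suc K * 3))
    last+δ : ∀ K → suc (suc (K * 2)) * 3 + suc (suc (suc K * 3)) ≡ suc (suc K * 3) + suc (suc (suc (K * 2)) * 3)
    last+δ = solve-∀
    3q+3+δ : ∀ q K → suc q * 3 + suc (suc (suc K * 3)) ≡ suc (suc ((suc q + suc K) * 3))
    3q+3+δ = solve-∀
    3q+3+δ-wrap : ∀ K j → suc (K + j) * 3 + suc (suc (suc K * 3)) ≡ suc (j * 3) + suc (suc (suc (K * 2)) * 3)
    3q+3+δ-wrap = solve-∀
    3q+1+δ : ∀ q K → suc (q * 3) + suc (suc (suc K * 3)) ≡ suc (q + suc K) * 3
    3q+1+δ = solve-∀
    3q+1+δ-wrap : ∀ K j → suc (suc (K + j) * 3) + suc (suc (suc K * 3)) ≡ suc (suc (j * 3)) + suc (suc (suc (K * 2)) * 3)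
    3q+1+δ-wrap = solve-∀
    3q+2+δ : ∀ q K → suc (suc (q * 3)) + suc (suc (suc K * 3)) ≡ suc (suc (q + suc K) * 3)
    3q+2+δ = solve-∀
    3q+2+δ-wrap : ∀ K j → suc (suc ((K + j) * 3)) + suc (suc (suc K * 3)) ≡ j * 3 + suc (suc (suc (K * 2)) * 3)
    3q+2+δ-wrap = solve-∀
    K+K+1≡T-1 : ∀ K → K + suc K ≡ suc (K * 2)
    K+K+1≡T-1 = solve-∀
    K+1<T : suc K < T
    K+1<T = s≤s (s≤s (m≤m*n K 2))
    q+K+1<T : ∀ {q} → q ≤ K → q + suc K < T
    q+K+1<T q≤K = s≤s (≤-trans (+-monoˡ-≤ (suc K) q≤K) (≤-reflexive (K+K+1≡T-1 K)))
    j≤K : ∀ {j} → suc (K + j) < T → j ≤ K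
    j≤K {j} K+j+1<T = +-cancelˡ-≤ K j K (≤-trans (s≤s⁻¹ (s≤s⁻¹ K+j+1<T)) (≤-reflexive (trans (*-comm K 2) (cong (K +_) (+-identityʳ K)))))
    elsewhere : ∀ d → d < n → d ≢ 0 → d ≢ T * 3 → canonical K ((d + δ) % n) ≡ canonical K d
    elsewhere d d<n d≢0 d≢3T with position d d<n
    ... | +0 zero _ = ⊥-elim (d≢0 refl)
    ... | +0 (suc q) q+1≤T with m<1+n⇒m<n∨m≡n (s≤s q+1≤T)
    ...   | inj₂ q+1≡T = ⊥-elim (d≢3T (cong (_* 3) q+1≡T))
    ...   | inj₁ q+1<T with suc q ≤? K
    ...     | yes q+1≤K = trans (cong (canonical K) (trans (cong (_% n) (3q+3+δ q K)) (m<n⇒m%n≡m (3q+2<n (q+K+1<T q+1≤K)))))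
                            (trans (canonical-2 K (suc q + suc K)) (trans (>⇒≤ᵇ-false (<-≤-trans (n<1+n K) (m≤n+m (suc K) (suc q))))
                              (sym (canonical-0 K (suc q)))))
    ...     | no q+1≰K with m≤n⇒∃[o]m+o≡n (s≤s⁻¹ (≰⇒> q+1≰K))
    ...       | j , refl = trans (cong (canonical K) (%-of-+n (suc (j * 3)) (3q+3+δ-wrap K j) (3q+1<n (≤-<-trans (j≤K q+1<T) K<T))))
                             (trans (canonical-1 K j) (trans (>⇒≤ᵇ-false (s≤s (j≤K q+1<T))) (sym (canonical-0 K (suc (K + j))))))
    elsewhere d d<n d≢0 d≢3T | +1 q q<T with q ≤? K
    ... | yes q≤K = trans (cong (canonical K) (trans (cong (_% n) (3q+1+δ q K)) (m<n⇒m%n≡m (3q<n (q+K+1<T q≤K)))))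
                      (trans (canonical-0 K (suc (q + suc K))) (sym (trans (canonical-1 K q) (>⇒≤ᵇ-false (s≤s q≤K)))))
    ... | no q≰K with m≤n⇒∃[o]m+o≡n (≰⇒> q≰K)
    ...   | j , refl = trans (cong (canonical K) (%-of-+n (suc (suc (j * 3))) (3q+1+δ-wrap K j) (3q+2<n (≤-<-trans (j≤K q<T) K<T))))
                         (trans (canonical-2 K j) (trans (≤⇒≤ᵇ-true (j≤K q<T))
                           (sym (trans (canonical-1 K (suc (K + j))) (≤⇒≤ᵇ-true (s≤s (m≤m+n K j)))))))
    elsewhere d d<n d≢0 d≢3T | +2 q q<T with q <? K
    ... | yes q<K = trans (cong (canonical K) (trans (cong (_% n) (3q+2+δ q K)) (m<n⇒m%n≡m (3q+1<n (q+K+1<T q<K)))))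
                      (trans (canonical-1 K (suc (q + suc K))) (trans (≤⇒≤ᵇ-true (s≤s (≤-trans (n≤1+n K) (m≤n+m (suc K) q))))
                        (sym (trans (canonical-2 K q) (≤⇒≤ᵇ-true (<⇒≤ q<K))))))
    ... | no q≮K with m≤n⇒∃[o]m+o≡n (≮⇒≥ q≮K)
    ...   | j , refl = trans (cong (canonical K) (%-of-+n (j * 3) (3q+2+δ-wrap K j) (3q<n (≤-trans (m≤n+m j K) (<⇒≤ q<T)))))
                         (trans (canonical-0 K j) (sym (trans (canonical-2 K (K + j)) (+-≤ᵇ-self K j))))

  canonicalSeq : ℕ → ℕ → ℕ → Bool
  canonicalSeq m c = rotate (canonical m) c

  canonicalSet : ℕ → ℕ → Subset n
  canonicalSet m c = subsetOf (canonicalSeq m c)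

  canonicalSeq-independent : ∀ m c → IndependentSeq (canonicalSeq m c)
  canonicalSeq-independent m c i now next =
    canonical-independent m _ (m%n<n (i + c) n) now (trans (cong (canonical m) (suc-% (i + c))) next)

  canonicalSeq-dominating : ∀ m c → DominatingSeq (canonicalSeq m c)
  canonicalSeq-dominating m c i now next next² = canonical-dominating m _ (m%n<n (i + c) n) now
    (trans (cong (canonical m) (suc-% (i + c))) next) (trans (cong (canonical m) (suc-suc-% (i + c))) next²)

  canonicalSeq-gap₂ : ∀ m c → m ≤ K → ∀ i → gap₂ (canonicalSeq m c) i ≡ zeroOr (suc (suc (m * 3))) ((i + c) % n)
  canonicalSeq-gap₂ m c m≤K i = trans (cong (canonicalSeq m c i ∧_) (cong (canonical m) (sym (suc-suc-% (i + c)))))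
    (canonical-gap₂ m m≤K _ (m%n<n (i + c) n))

  canonicalSet-indepDominating : ∀ m c → IndepDominating (CycleAdj n) (canonicalSet m c)
  canonicalSet-indepDominating m c =
    seqRules⇒indepDominating (rotate-periodic (canonical m) c) (canonicalSeq-independent m c) (canonicalSeq-dominating m c)

  3m+2<n : ∀ {m} → m ≤ K → suc (suc (m * 3)) < n
  3m+2<n m≤K = 3q+2<n (≤-<-trans m≤K K<T)

  weight-gap₂-canonicalSeq : ∀ m c → m ≤ K → weight (gap₂ (canonicalSeq m c)) ≡ 2
  weight-gap₂-canonicalSeq m c m≤K = begin
    sumTo (λ d → 𝟙 (gap₂ (canonicalSeq m c) d)) n     ≡⟨ sumTo-cong n (λ d _ → cong 𝟙 (trans (canonicalSeq-gap₂ m c m≤K d) (cong gaps (+-comm d c)))) ⟩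
    sumTo (λ d → 𝟙 (gaps (c + d))) n                  ≡⟨ sumTo-rotate (λ x → 𝟙 (gaps x)) n (λ d → cong (λ z → 𝟙 (zeroOr p z)) ([m+n]%n≡m%n d n)) c ⟩
    sumTo (λ d → 𝟙 (gaps d)) n                        ≡⟨ sumTo-cong n (λ d d<n → cong (λ z → 𝟙 (zeroOr p z)) (m<n⇒m%n≡m d<n)) ⟩
    sumTo (λ d → 𝟙 (zeroOr p d)) n                    ≡⟨ sumTo-𝟙-zeroOr p n (λ ()) (3m+2<n m≤K) ⟩
    2                                                 ∎
    where
    open ≡-Reasoning
    p = suc (suc (m * 3))
    gaps : ℕ → Bool
    gaps x = zeroOr p (x % n)

  x+x+x≡x*3 : ∀ x → x + x + x ≡ x * 3
  x+x+x≡x*3 = solve-∀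

  ∣canonicalSet∣ : ∀ m c → m ≤ K → ∣ canonicalSet m c ∣ ≡ suc T
  ∣canonicalSet∣ m c m≤K = begin
    ∣ canonicalSet m c ∣                       ≡⟨ ∣∣≡weight (canonicalSet m c) ⟩
    weight (seqOf (canonicalSet m c))          ≡⟨ sumTo-cong n (λ d _ → cong 𝟙 (seqOf-subsetOf (rotate-periodic (canonical m) c) d)) ⟩
    weight (canonicalSeq m c)                  ≡⟨ *-cancelʳ-≡ _ _ 3 three-weights ⟩
    suc T                                      ∎
    where
    open ≡-Reasoning
    n+2≡3T+3 : ∀ T → suc (T * 3) + 2 ≡ suc T * 3
    n+2≡3T+3 = solve-∀
    w = weight (canonicalSeq m c)
    three-weights : w * 3 ≡ suc T * 3
    three-weights = trans (sym (x+x+x≡x*3 w)) (trans (3*weight≡n+gaps (rotate-periodic (canonical m) c)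
      (canonicalSeq-independent m c) (canonicalSeq-dominating m c)) (trans (cong (n +_) (weight-gap₂-canonicalSeq m c m≤K)) (n+2≡3T+3 T)))

  indepDominating⇒T<∣∣ : ∀ Y → IndepDominating (CycleAdj n) Y → suc T ≤ ∣ Y ∣
  indepDominating⇒T<∣∣ Y ids = subst (suc T ≤_) (sym (∣∣≡weight Y)) (≰⇒> T≱w)
    where
    w = weight (seqOf Y)
    T≱w : ¬ w ≤ T
    T≱w w≤T = <-irrefl refl (≤-trans (n≤3*weight (seqOf-periodic Y) (indepDominating⇒dominatingSeq Y ids))
      (subst (_≤ T * 3) (sym (x+x+x≡x*3 w)) (*-monoˡ-≤ 3 w≤T)))

  canonicalSet-iset : ∀ m c → m ≤ K → ISet (CycleAdj n) (canonicalSet m c)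
  canonicalSet-iset m c m≤K = canonicalSet-indepDominating m c
    , λ Y ids → subst (_≤ ∣ Y ∣) (sym (∣canonicalSet∣ m c m≤K)) (indepDominating⇒T<∣∣ Y ids)

  3[T+1]≡n+2 : suc T + suc T + suc T ≡ n + 2
  3[T+1]≡n+2 = lemma T
    where
    lemma : ∀ T → suc T + suc T + suc T ≡ suc (T * 3) + 2
    lemma = solve-∀

  iset-weight : ∀ X → ISet (CycleAdj n) X → weight (seqOf X) ≡ suc T
  iset-weight X (ids , minimal) = ≤-antisym
    (subst₂ _≤_ (∣∣≡weight X) (∣canonicalSet∣ 0 0 z≤n) (minimal (canonicalSet 0 0) (canonicalSet-indepDominating 0 0)))
    (subst (suc T ≤_) (∣∣≡weight X) (indepDominating⇒T<∣∣ X ids))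

  iset-two-gaps : ∀ X → ISet (CycleAdj n) X → weight (gap₂ (seqOf X)) ≡ 2
  iset-two-gaps X iset@(ids , _) = +-cancelˡ-≡ n _ 2 (begin
    n + weight (gap₂ (seqOf X))                                      ≡⟨ sym (3*weight≡n+gaps (seqOf-periodic X)
                                                                          (indepDominating⇒independentSeq X ids) (indepDominating⇒dominatingSeq X ids)) ⟩
    weight (seqOf X) + weight (seqOf X) + weight (seqOf X)           ≡⟨ cong (λ z → z + z + z) (iset-weight X iset) ⟩
    suc T + suc T + suc T                                            ≡⟨ 3[T+1]≡n+2 ⟩
    n + 2                                                            ∎)
    where open ≡-Reasoning

  record GapPair (f : ℕ → Bool) (β : ℕ) : Set where
    field
      periodic : Periodic f
      independent : IndependentSeq f
      dominating : DominatingSeq f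
      gap-at-0 : gap₂ f 0 ≡ true
      gap-at-β : gap₂ f β ≡ true
      0<β : 0 < β
      β<n : β < n
      no-other-gap : ∀ s → 0 < s → s < n → s ≢ β → gap₂ f s ≡ false

  gapPairAt : ∀ X → ISet (CycleAdj n) X → ∀ a → gap₂ (seqOf X) a ≡ true → ∃ λ β → GapPair (shift (seqOf X) a) β
  gapPairAt X iset@(ids , _) a gap-a = from-second-gap (sumTo-𝟙-≡1 (λ s → gap₂ f (a + suc s)) (T * 3) one-more)
    where
    open ≡-Reasoning
    f = seqOf X
    gaps-from-a : ℕ → ℕ
    gaps-from-a s = 𝟙 (gap₂ f (a + s))
    one-more : sumTo (λ s → gaps-from-a (suc s)) (T * 3) ≡ 1
    one-more = suc-injective (begin
      1 + sumTo (λ s → gaps-from-a (suc s)) (T * 3)                 ≡⟨ cong (λ z → 𝟙 z + sumTo (λ s → gaps-from-a (suc s)) (T * 3)) (sym (trans (cong (gap₂ f) (+-identityʳ a)) gap-a)) ⟩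
      gaps-from-a 0 + sumTo (λ s → gaps-from-a (suc s)) (T * 3)     ≡⟨ sym (sumTo-head gaps-from-a (T * 3)) ⟩
      sumTo gaps-from-a n                                           ≡⟨ sumTo-rotate (λ x → 𝟙 (gap₂ f x)) n (λ d → cong 𝟙 (gap₂-periodic (seqOf-periodic X) d)) a ⟩
      weight (gap₂ f)                                               ≡⟨ iset-two-gaps X iset ⟩
      2                                                             ∎)
    from-second-gap : (Σ ℕ λ s₀ → s₀ < T * 3 × gap₂ f (a + suc s₀) ≡ true × (∀ s → s < T * 3 → s ≢ s₀ → gap₂ f (a + suc s) ≡ false)) →
      ∃ λ β → GapPair (shift f a) β
    from-second-gap (s₀ , s₀<3T , gap-s₀ , others) = suc s₀ , record
      { periodic = shift-periodic a (seqOf-periodic X)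
      ; independent = IndependentSeq-shift a (indepDominating⇒independentSeq X ids)
      ; dominating = DominatingSeq-shift a (indepDominating⇒dominatingSeq X ids)
      ; gap-at-0 = trans (gap₂-shift f a 0) (trans (cong (gap₂ f) (+-identityʳ a)) gap-a)
      ; gap-at-β = trans (gap₂-shift f a (suc s₀)) gap-s₀
      ; 0<β = s≤s z≤n
      ; β<n = s≤s s₀<3T
      ; no-other-gap = λ { (suc s) _ s<n s≢β → trans (gap₂-shift f a (suc s)) (others s (s≤s⁻¹ s<n) (s≢β ∘ cong suc)) }
      }

  gap-distances : ∀ {f β} → GapPair f β → Σ ℕ λ j → Σ ℕ λ j′ → β ≡ 2 + j * 3 × n ≡ 2 + β + j′ * 3
  gap-distances {f} {β} gp = proj₁ first , proj₁ second , proj₂ first , proj₂ second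
    where
    open GapPair gp
    f0 : f 0 ≡ true
    f0 = ∧-conicalˡ _ _ gap-at-0
    f2 : f 2 ≡ true
    f2 = ∧-conicalʳ _ _ gap-at-0
    fβ : f β ≡ true
    fβ = ∧-conicalˡ _ _ gap-at-β
    fn : f n ≡ true
    fn = trans (periodic 0) f0
    2≤β : 2 ≤ β
    2≤β = ≤∧≢⇒< 0<β (λ 1≡β → independent 0 f0 (subst (λ z → f z ≡ true) (sym 1≡β) fβ))
    β+2≤n : 2 + β ≤ n
    β+2≤n = ≤∧≢⇒< β<n (λ β+1≡n → independent β fβ (trans (cong f β+1≡n) fn))
    first : ∃ λ j → β ≡ 2 + j * 3
    first = no-gap₂⇒distance≡3j independent dominating 2 β 2≤β f2 fβ
      (λ s 2≤s s<β → no-other-gap s (≤-trans (s≤s z≤n) 2≤s) (<-trans s<β β<n) (<⇒≢ s<β))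
    second : ∃ λ j′ → n ≡ 2 + β + j′ * 3
    second = no-gap₂⇒distance≡3j independent dominating (2 + β) n β+2≤n (∧-conicalʳ _ _ gap-at-β) fn
      (λ s β+2≤s s<n → no-other-gap s (<-≤-trans 0<β (≤-trans (n≤1+n β) (≤-trans (n≤1+n _) β+2≤s))) s<n
        (λ s≡β → <-irrefl (sym s≡β) (≤-trans (n≤1+n (suc β)) β+2≤s)))

  GapPair-gap₂ : ∀ {f β} → GapPair f β → ∀ s → s < n → gap₂ f s ≡ zeroOr β s
  GapPair-gap₂ {f} {β} gp s s<n with s ≟ 0
  ... | yes refl = gap-at-0
    where open GapPair gp
  ... | no s≢0 with s ≟ β
  ...   | yes refl = trans gap-at-β (sym (trans (cong (_∨ (s ≡ᵇ s)) (≢⇒≡ᵇ-false s 0 s≢0)) (≡ᵇ-refl s)))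
    where open GapPair gp
  ...   | no s≢β = trans (no-other-gap s (n≢0⇒n>0 s≢0) s<n s≢β) (sym (cong₂ _∨_ (≢⇒≡ᵇ-false s 0 s≢0) (≢⇒≡ᵇ-false s β s≢β)))
    where open GapPair gp

  -- A configuration is determined by its 2-gaps, so the gap pair (0, 3m + 2) forces the canonical set m.
  GapPair⇒canonical : ∀ {g} m → m ≤ K → GapPair g (2 + m * 3) → ∀ i → g i ≡ canonicalSeq m 0 i
  GapPair⇒canonical {g} m m≤K gp = gap₂-rigid independent dominating
    (canonicalSeq-independent m 0) (canonicalSeq-dominating m 0) 0 (∧-conicalˡ _ _ gap-at-0) refl same-gaps
    where
    open GapPair gp
    same-gaps : ∀ s → gap₂ g s ≡ gap₂ (canonicalSeq m 0) s
    same-gaps s = begin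
      gap₂ g s                        ≡⟨ sym (periodic-% (gap₂-periodic periodic) s) ⟩
      gap₂ g (s % n)                  ≡⟨ GapPair-gap₂ gp (s % n) (m%n<n s n) ⟩
      zeroOr (2 + m * 3) (s % n)      ≡⟨ cong (λ z → zeroOr (2 + m * 3) (z % n)) (sym (+-identityʳ s)) ⟩
      zeroOr (2 + m * 3) ((s + 0) % n) ≡⟨ sym (canonicalSeq-gap₂ m 0 m≤K s) ⟩
      gap₂ (canonicalSeq m 0) s       ∎
      where open ≡-Reasoning

  shift-canonical⇒canonicalSet : ∀ X a m → (∀ s → seqOf X (a + s) ≡ canonicalSeq m 0 s) → X ≡ canonicalSet m (n ∸ a % n)
  shift-canonical⇒canonicalSet X a m shifted≡ = trans (sym (subsetOf-seqOf X)) (subsetOf-cong _ _ pointwise)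
    where
    open ≡-Reasoning
    c = n ∸ a % n
    pointwise : ∀ i → i < n → seqOf X i ≡ canonicalSeq m c i
    pointwise i _ = begin
      seqOf X i                       ≡⟨ sym (periodic-% (seqOf-periodic X) i) ⟩
      seqOf X (i % n)                 ≡⟨ cong (seqOf X) (sym (+-∸%+-% a i)) ⟩
      seqOf X ((i + (c + a)) % n)     ≡⟨ periodic-% (seqOf-periodic X) (i + (c + a)) ⟩
      seqOf X (i + (c + a))           ≡⟨ cong (seqOf X) (trans (cong (i +_) (+-comm c a)) (trans (sym (+-assoc i a c))
                                           (trans (cong (_+ c) (+-comm i a)) (+-assoc a i c)))) ⟩
      seqOf X (a + (i + c))           ≡⟨ shifted≡ (i + c) ⟩
      canonical m ((i + c + 0) % n)   ≡⟨ cong (λ z → canonical m (z % n)) (+-identityʳ (i + c)) ⟩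
      canonicalSeq m c i              ∎

  GapPair⇒canonicalSet : ∀ X a m → m ≤ K → GapPair (shift (seqOf X) a) (2 + m * 3) → X ≡ canonicalSet m (n ∸ a % n)
  GapPair⇒canonicalSet X a m m≤K gp = shift-canonical⇒canonicalSet X a m (GapPair⇒canonical m m≤K gp)

  -- The two 2-gaps split the n - 4 = 3(2K + 1) cells of 3-gaps as 3j and 3j′, so one of j, j′ is at most K.
  short-arc : ∀ j j′ → n ≡ 2 + (2 + j * 3) + j′ * 3 → K < j → j′ ≤ K
  short-arc j j′ n≡ K<j = +-cancelˡ-≤ (suc K) j′ K (≤-trans (+-monoˡ-≤ j′ K<j)
    (≤-reflexive (trans j+j′≡2K+1 (cong suc (trans (*-comm K 2) (cong (K +_) (+-identityʳ K)))))))
    where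
    cells : ∀ j j′ → 4 + (j + j′) * 3 ≡ 2 + (2 + j * 3) + j′ * 3
    cells = solve-∀
    n≡4+3[2K+1] : ∀ K → suc (suc (suc (K * 2)) * 3) ≡ 4 + suc (K * 2) * 3
    n≡4+3[2K+1] = solve-∀
    j+j′≡2K+1 : j + j′ ≡ suc (K * 2)
    j+j′≡2K+1 = *-cancelʳ-≡ _ _ 3 (+-cancelˡ-≡ 4 _ _ (trans (cells j j′) (trans (sym n≡) (n≡4+3[2K+1] K))))

  GapPair-flip : ∀ X a β j′ → GapPair (shift (seqOf X) a) β → n ≡ 2 + β + j′ * 3 → ∀ β′ →
    GapPair (shift (seqOf X) (a + β)) β′ → β′ ≡ 2 + j′ * 3
  GapPair-flip X a β j′ gp n≡ β′ gp′ with 2 + j′ * 3 ≟ β′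
  ... | yes e = sym e
  ... | no e = ⊥-elim (true≢false (trans (sym gap-at-j′) (no-other-gap′ _ (s≤s z≤n)
                 (subst (2 + j′ * 3 <_) (sym n≡) (+-monoˡ-< (j′ * 3) (m<m+n 2 0<β))) e)))
    where
    open GapPair gp using (0<β; gap-at-0)
    open GapPair gp′ using () renaming (no-other-gap to no-other-gap′)
    gap-at-j′ : gap₂ (shift (seqOf X) (a + β)) (2 + j′ * 3) ≡ true
    gap-at-j′ = begin
      gap₂ (shift (seqOf X) (a + β)) (2 + j′ * 3)   ≡⟨ gap₂-shift (seqOf X) (a + β) _ ⟩
      gap₂ (seqOf X) (a + β + (2 + j′ * 3))         ≡⟨ cong (gap₂ (seqOf X)) (trans (+-assoc a β _) (cong (a +_) (sym (trans n≡ (sym (trans (+-suc β _) (cong suc (+-suc β _)))))))) ⟩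
      gap₂ (seqOf X) (a + n)                        ≡⟨ gap₂-periodic (seqOf-periodic X) a ⟩
      gap₂ (seqOf X) a                              ≡⟨ cong (gap₂ (seqOf X)) (sym (+-identityʳ a)) ⟩
      gap₂ (seqOf X) (a + 0)                        ≡⟨ sym (gap₂-shift (seqOf X) a 0) ⟩
      gap₂ (shift (seqOf X) a) 0                    ≡⟨ gap-at-0 ⟩
      true                                          ∎
      where open ≡-Reasoning

  iset⇒canonical : ∀ X → ISet (CycleAdj n) X → Σ ℕ λ m → Σ ℕ λ c → m ≤ K × X ≡ canonicalSet m c
  iset⇒canonical X iset = from-gap (sumTo-𝟙-pos (gap₂ (seqOf X)) n (subst (0 <_) (sym (iset-two-gaps X iset)) (s≤s z≤n)))
    where
    Result : Set
    Result = Σ ℕ λ m → Σ ℕ λ c → m ≤ K × X ≡ canonicalSet m c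
    from-pair : ∀ a β → GapPair (shift (seqOf X) a) β → Result
    from-pair a β gp = from-distances (gap-distances gp)
      where
      from-distances : (Σ ℕ λ j → Σ ℕ λ j′ → β ≡ 2 + j * 3 × n ≡ 2 + β + j′ * 3) → Result
      from-distances (j , j′ , β≡ , n≡) with j ≤? K
      ... | yes j≤K = j , n ∸ a % n , j≤K , GapPair⇒canonicalSet X a j j≤K (subst (GapPair _) β≡ gp)
      ... | no j≰K = j′ , n ∸ (a + β) % n , j′≤K
          , GapPair⇒canonicalSet X (a + β) j′ j′≤K (subst (GapPair _) (GapPair-flip X a β j′ gp n≡ β′ gp′) gp′)
        where
        j′≤K : j′ ≤ K
        j′≤K = short-arc j j′ (subst (λ b → n ≡ 2 + b + j′ * 3) β≡ n≡) (≰⇒> j≰K)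
        second-pair : ∃ λ β′ → GapPair (shift (seqOf X) (a + β)) β′
        second-pair = gapPairAt X iset (a + β) (trans (sym (gap₂-shift (seqOf X) a β)) (GapPair.gap-at-β gp))
        β′ = proj₁ second-pair
        gp′ = proj₂ second-pair
    from-gap : (Σ ℕ λ a → a < n × gap₂ (seqOf X) a ≡ true) → Result
    from-gap (a , _ , gap-a) = from-pair a _ (proj₂ (gapPairAt X iset a gap-a))

  canonicalSet-cong-% : ∀ m c c′ → c % n ≡ c′ % n → canonicalSet m c ≡ canonicalSet m c′
  canonicalSet-cong-% m c c′ c≡c′ = subsetOf-cong _ _ λ i _ → cong (canonical m)
    (trans (sym (%-absorbʳ i c)) (trans (cong (λ z → (i + z) % n) c≡c′) (%-absorbʳ i c′)))

  -- 3 (2T + 1) = 2n + 1, so 2T + 1 is the inverse of 3 modulo n.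
  3⁻¹ : ℕ
  3⁻¹ = suc (T * 2)

  *3*3⁻¹ : ∀ t → (t * 3) % n * 3⁻¹ % n ≡ t % n
  *3*3⁻¹ t = begin
    (t * 3) % n * 3⁻¹ % n     ≡⟨ %-absorb-*ˡ (t * 3) 3⁻¹ ⟩
    t * 3 * 3⁻¹ % n           ≡⟨ cong (_% n) (t*3*3⁻¹ T t) ⟩
    (t + t * 2 * n) % n       ≡⟨ [m+kn]%n≡m%n t (t * 2) n ⟩
    t % n                     ∎
    where
    open ≡-Reasoning
    t*3*3⁻¹ : ∀ T t → t * 3 * suc (T * 2) ≡ t + t * 2 * suc (T * 3)
    t*3*3⁻¹ = solve-∀

  *3-injective : ∀ t t′ → t < n → t′ < n → (t * 3) % n ≡ (t′ * 3) % n → t ≡ t′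
  *3-injective t t′ t<n t′<n 3t≡3t′ = begin
    t                       ≡⟨ sym (m<n⇒m%n≡m t<n) ⟩
    t % n                   ≡⟨ sym (*3*3⁻¹ t) ⟩
    (t * 3) % n * 3⁻¹ % n   ≡⟨ cong (λ z → z * 3⁻¹ % n) 3t≡3t′ ⟩
    (t′ * 3) % n * 3⁻¹ % n  ≡⟨ *3*3⁻¹ t′ ⟩
    t′ % n                  ≡⟨ m<n⇒m%n≡m t′<n ⟩
    t′                      ∎
    where open ≡-Reasoning

  canonicalSet-rotation-by-3 : ∀ m c → canonicalSet m c ≡ canonicalSet m ((c * 3⁻¹) % n * 3)
  canonicalSet-rotation-by-3 m c = canonicalSet-cong-% m c _ (sym (begin
    (c * 3⁻¹) % n * 3 % n    ≡⟨ %-absorb-*ˡ (c * 3⁻¹) 3 ⟩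
    c * 3⁻¹ * 3 % n          ≡⟨ cong (_% n) (c*3⁻¹*3 T c) ⟩
    (c + c * 2 * n) % n      ≡⟨ [m+kn]%n≡m%n c (c * 2) n ⟩
    c % n                    ∎))
    where
    open ≡-Reasoning
    c*3⁻¹*3 : ∀ T c → c * suc (T * 2) * 3 ≡ c + c * 2 * suc (T * 3)
    c*3⁻¹*3 = solve-∀

  -- Two canonical sets are compared through the positions of their 2-gaps.
  canonicalSet-injective : ∀ m m′ c c′ → m ≤ K → m′ ≤ K → canonicalSet m c ≡ canonicalSet m′ c′ → m ≡ m′ × c % n ≡ c′ % n
  canonicalSet-injective m m′ c c′ m≤K m′≤K sets≡ = compare-gaps (gap-of-image 0 (s≤s z≤n) refl) (gap-of-image p (3m+2<n m≤K) (≡ᵇ-refl p))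
    where
    open ≡-Reasoning
    p = 2 + m * 3
    p′ = 2 + m′ * 3
    same : ∀ i → canonicalSeq m c i ≡ canonicalSeq m′ c′ i
    same i = trans (sym (seqOf-subsetOf (rotate-periodic (canonical m) c) i))
      (trans (cong (λ X → seqOf X i) sets≡) (seqOf-subsetOf (rotate-periodic (canonical m′) c′) i))
    image : ℕ → ℕ
    image d = (toℕ (unrotate c d) + c′) % n
    gap-of-image : ∀ d → d < n → zeroOr p d ≡ true → image d ≡ 0 ⊎ image d ≡ p′
    gap-of-image d d<n gap = zeroOr-true p′ _ (begin
      zeroOr p′ (image d)              ≡⟨ sym (canonicalSeq-gap₂ m′ c′ m′≤K i) ⟩
      gap₂ (canonicalSeq m′ c′) i      ≡⟨ cong₂ _∧_ (sym (same i)) (sym (same (2 + i))) ⟩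
      gap₂ (canonicalSeq m c) i        ≡⟨ canonicalSeq-gap₂ m c m≤K i ⟩
      zeroOr p ((i + c) % n)           ≡⟨ cong (zeroOr p) (rotate-unrotate c d d<n) ⟩
      zeroOr p d                       ≡⟨ gap ⟩
      true                             ∎)
      where i = toℕ (unrotate c d)
    i₀ = toℕ (unrotate c 0)
    i₁ = toℕ (unrotate c p)
    i₁≡i₀+p : i₁ % n ≡ (i₀ + p) % n
    i₁≡i₀+p = +-cancelˡ-% c i₁ (i₀ + p) (begin
      (c + i₁) % n             ≡⟨ cong (_% n) (+-comm c i₁) ⟩
      (i₁ + c) % n             ≡⟨ rotate-unrotate c p (3m+2<n m≤K) ⟩
      p                        ≡⟨ sym (m<n⇒m%n≡m (3m+2<n m≤K)) ⟩
      (0 + p) % n              ≡⟨ cong (λ z → (z + p) % n) (sym (rotate-unrotate c 0 (s≤s z≤n))) ⟩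
      ((i₀ + c) % n + p) % n   ≡⟨ %-absorbˡ (i₀ + c) p ⟩
      (i₀ + c + p) % n         ≡⟨ cong (_% n) (trans (cong (_+ p) (+-comm i₀ c)) (+-assoc c i₀ p)) ⟩
      (c + (i₀ + p)) % n       ∎)
    image-p : image p ≡ (image 0 + p) % n
    image-p = begin
      (i₁ + c′) % n            ≡⟨ sym (%-absorbˡ i₁ c′) ⟩
      (i₁ % n + c′) % n        ≡⟨ cong (λ z → (z + c′) % n) i₁≡i₀+p ⟩
      ((i₀ + p) % n + c′) % n  ≡⟨ %-absorbˡ (i₀ + p) c′ ⟩
      (i₀ + p + c′) % n        ≡⟨ cong (_% n) (trans (+-assoc i₀ p c′) (trans (cong (i₀ +_) (+-comm p c′)) (sym (+-assoc i₀ c′ p)))) ⟩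
      (i₀ + c′ + p) % n        ≡⟨ sym (%-absorbˡ (i₀ + c′) p) ⟩
      (image 0 + p) % n        ∎
    p′+p<n : p′ + p < n
    p′+p<n = ≤-trans (s≤s (+-mono-≤ (s≤s (s≤s (*-monoˡ-≤ 3 m′≤K))) (s≤s (s≤s (*-monoˡ-≤ 3 m≤K)))))
      (subst (suc (2 + K * 3 + (2 + K * 3)) ≤_) (gaps-fit K) (s≤s (m≤n+m _ 2)))
      where
      gaps-fit : ∀ K → 3 + (2 + K * 3 + (2 + K * 3)) ≡ suc (suc (suc (K * 2)) * 3)
      gaps-fit = solve-∀
    compare-gaps : image 0 ≡ 0 ⊎ image 0 ≡ p′ → image p ≡ 0 ⊎ image p ≡ p′ → m ≡ m′ × c % n ≡ c′ % n
    compare-gaps (inj₁ y₀≡0) y₁ = same-m y₁ , +-cancelˡ-% i₀ c c′ (trans (rotate-unrotate c 0 (s≤s z≤n)) (sym y₀≡0))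
      where
      y₁≡p : image p ≡ p
      y₁≡p = trans image-p (trans (cong (λ z → (z + p) % n) y₀≡0) (m<n⇒m%n≡m (3m+2<n m≤K)))
      same-m : image p ≡ 0 ⊎ image p ≡ p′ → m ≡ m′
      same-m (inj₁ y₁≡0) = ⊥-elim (0≢1+n (trans (sym y₁≡0) y₁≡p))
      same-m (inj₂ y₁≡p′) = *-cancelʳ-≡ m m′ 3 (suc-injective (suc-injective (trans (sym y₁≡p) y₁≡p′)))
    compare-gaps (inj₂ y₀≡p′) y₁ = ⊥-elim (impossible y₁)
      where
      y₁≡p′+p : image p ≡ p′ + p
      y₁≡p′+p = trans image-p (trans (cong (λ z → (z + p) % n) y₀≡p′) (m<n⇒m%n≡m p′+p<n))
      impossible : image p ≡ 0 ⊎ image p ≡ p′ → ⊥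
      impossible (inj₁ y₁≡0) = 0≢1+n (trans (sym y₁≡0) y₁≡p′+p)
      impossible (inj₂ y₁≡p′) = 0≢1+n (+-cancelˡ-≡ p′ 0 p (trans (+-identityʳ p′) (trans (sym y₁≡p′) y₁≡p′+p)))

  iset⇒indexed : ∀ X → ISet (CycleAdj n) X → Σ ℕ λ m → Σ ℕ λ t → m ≤ K × t < n × X ≡ canonicalSet m (t * 3)
  iset⇒indexed X iset = reindex (iset⇒canonical X iset)
    where
    reindex : (Σ ℕ λ m → Σ ℕ λ c → m ≤ K × X ≡ canonicalSet m c) → Σ ℕ λ m → Σ ℕ λ t → m ≤ K × t < n × X ≡ canonicalSet m (t * 3)
    reindex (m , c , m≤K , X≡) = m , (c * 3⁻¹) % n , m≤K , m%n<n (c * 3⁻¹) n , trans X≡ (canonicalSet-rotation-by-3 m c)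

-- The Hamiltonian path

even-or-odd : ∀ K → (∃ λ h → K ≡ h * 2) ⊎ (∃ λ h → K ≡ suc (h * 2))
even-or-odd zero = inj₁ (0 , refl)
even-or-odd (suc K) with even-or-odd K
... | inj₁ (h , K≡2h) = inj₂ (h , cong suc K≡2h)
... | inj₂ (h , K≡2h+1) = inj₁ (suc h , cong suc K≡2h+1)

module Path (K : ℕ) where

  open Canonical K

  k : ℕ
  k = suc K

  Index : Set
  Index = ℕ × ℕ

  InRange : Index → Set
  InRange (m , t) = m ≤ K × t < n

  setAt : Index → Subset n
  setAt (m , t) = canonicalSet m (t * 3)

  _⟶_ : Index → Index → Set
  p ⟶ q = IAdj (CycleAdj n) (setAt p) (setAt q)

  descend : ∀ m → suc m ≤ K → ∀ t → (suc m , t) ⟶ (m , t)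
  descend m m+1≤K t = Slide⇒IAdj (WindowSlide⇒Slide (lowerSlide m m+1≤K) (t * 3) (t * 3) (cong (_% n) (sym (+-identityʳ (t * 3)))))

  ascend : ∀ m → suc m ≤ K → ∀ t → (m , t) ⟶ (suc m , t)
  ascend m m+1≤K t = Slide⇒IAdj (Slide-reverse (WindowSlide⇒Slide (lowerSlide m m+1≤K) (t * 3) (t * 3) (cong (_% n) (sym (+-identityʳ (t * 3))))))

  unwrap : ∀ m → suc m ≤ K → ∀ t t′ → (t′ * 3) % n ≡ (t * 3 + 3) % n → (suc m , t′) ⟶ (m , t)
  unwrap m m+1≤K t t′ t′≡t+1 = Slide⇒IAdj (Slide-reverse (WindowSlide⇒Slide (wrapSlide m m+1≤K) (t * 3) (t′ * 3) t′≡t+1))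

  top-step : ∀ t t′ → (t′ * 3) % n ≡ (t * 3 + suc (suc (k * 3))) % n → (K , t) ⟶ (K , t′)
  top-step t t′ e = Slide⇒IAdj (WindowSlide⇒Slide topSlide (t * 3) (t′ * 3) e)

  ladder : ℕ → ℕ → List Index
  ladder b zero = []
  ladder b (suc t) = (b , t) ∷ (suc b , t) ∷ ladder b t

  twoLevels : ℕ → List Index
  twoLevels b = (suc b , T * 3) ∷ ladder b (T * 3) ++ (b , T * 3) ∷ []

  lowerLevels : ℕ → List Index
  lowerLevels zero = []
  lowerLevels (suc h) = twoLevels (h * 2) ++ lowerLevels h

  -- A top step shifts t by 3k + 1 ≡ −3k (mod n), so two of them advance t by one.
  topRun : ℕ → ℕ → List Index
  topRun j zero = []
  topRun j (suc l) = (K , j) ∷ (K , j + suc (k * 3)) ∷ topRun (suc j) l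

  topLevel : List Index
  topLevel = (K , k * 3) ∷ topRun 0 (k * 3)

  ladder-linked : ∀ b → suc b ≤ K → ∀ t rest → Linked _⟶_ ((suc b , 0) ∷ rest) → Linked _⟶_ ((suc b , t) ∷ ladder b t ++ rest)
  ladder-linked b b+1≤K zero rest linked = linked
  ladder-linked b b+1≤K (suc t) rest linked =
    unwrap b b+1≤K t (suc t) (cong (_% n) (+-comm 3 (t * 3))) ∷ ascend b b+1≤K t ∷ ladder-linked b b+1≤K t rest linked

  twoLevels-linked : ∀ b → suc b ≤ K → ∀ rest → Linked _⟶_ ((b , T * 3) ∷ rest) → Linked _⟶_ (twoLevels b ++ rest)
  twoLevels-linked b b+1≤K rest linked = subst (λ l → Linked _⟶_ ((suc b , T * 3) ∷ l)) (sym (++-assoc (ladder b (T * 3)) _ rest))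
    (ladder-linked b b+1≤K (T * 3) ((b , T * 3) ∷ rest) (unwrap b b+1≤K (T * 3) 0 n-1+1≡0 ∷ linked))
    where
    3[n-1]+3≡3n : ∀ K → suc (suc (K * 2)) * 3 * 3 + 3 ≡ 0 + 3 * suc (suc (suc (K * 2)) * 3)
    3[n-1]+3≡3n = solve-∀
    n-1+1≡0 : (0 * 3) % n ≡ (T * 3 * 3 + 3) % n
    n-1+1≡0 = sym (trans (cong (_% n) (3[n-1]+3≡3n K)) ([m+kn]%n≡m%n 0 3 n))

  lowerLevels-linked : ∀ h → h * 2 ≤ K → Linked _⟶_ ((h * 2 , T * 3) ∷ lowerLevels h)
  lowerLevels-linked zero _ = [-]
  lowerLevels-linked (suc h) 2h+2≤K = descend (suc (h * 2)) 2h+2≤K (T * 3)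
    ∷ twoLevels-linked (h * 2) (≤-trans (n≤1+n _) 2h+2≤K) (lowerLevels h) (lowerLevels-linked h (≤-trans (n≤1+n _) (≤-trans (n≤1+n _) 2h+2≤K)))

  topRun-linked : ∀ j l rest → Linked _⟶_ ((K , (j + l) + k * 3) ∷ rest) → Linked _⟶_ ((K , j + k * 3) ∷ topRun j l ++ rest)
  topRun-linked j zero rest linked = subst (λ z → Linked _⟶_ ((K , z + k * 3) ∷ rest)) (+-identityʳ j) linked
  topRun-linked j (suc l) rest linked = top-step (j + k * 3) j back ∷ top-step j (j + suc (k * 3)) forth
    ∷ subst (λ z → Linked _⟶_ ((K , z) ∷ topRun (suc j) l ++ rest)) (sym (+-suc j (k * 3)))
        (topRun-linked (suc j) l rest (subst (λ z → Linked _⟶_ ((K , z + k * 3) ∷ rest)) (+-suc j l) linked))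
    where
    back-≡ : ∀ K j → (j + suc K * 3) * 3 + suc (suc (suc K * 3)) ≡ j * 3 + 2 * suc (suc (suc (K * 2)) * 3)
    back-≡ = solve-∀
    forth-≡ : ∀ K j → (j + suc (suc K * 3)) * 3 ≡ (j * 3 + suc (suc (suc K * 3))) + 1 * suc (suc (suc (K * 2)) * 3)
    forth-≡ = solve-∀
    back : (j * 3) % n ≡ ((j + k * 3) * 3 + suc (suc (k * 3))) % n
    back = sym (trans (cong (_% n) (back-≡ K j)) ([m+kn]%n≡m%n (j * 3) 2 n))
    forth : ((j + suc (k * 3)) * 3) % n ≡ (j * 3 + suc (suc (k * 3))) % n
    forth = trans (cong (_% n) (forth-≡ K j)) ([m+kn]%n≡m%n (j * 3 + suc (suc (k * 3))) 1 n)

  k*3+k*3≡T*3 : k * 3 + k * 3 ≡ T * 3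
  k*3+k*3≡T*3 = lemma K
    where
    lemma : ∀ K → suc K * 3 + suc K * 3 ≡ suc (suc (K * 2)) * 3
    lemma = solve-∀

  n≡3k+1+3k : n ≡ k * 3 + suc (k * 3)
  n≡3k+1+3k = lemma K
    where
    lemma : ∀ K → suc (suc (suc (K * 2)) * 3) ≡ suc K * 3 + suc (suc K * 3)
    lemma = solve-∀

  path-K-even-linked : ∀ h → K ≡ h * 2 → Linked _⟶_ (topLevel ++ lowerLevels h)
  path-K-even-linked h K≡2h = topRun-linked 0 (k * 3) (lowerLevels h)
    (subst (λ t → Linked _⟶_ ((K , t) ∷ lowerLevels h)) (sym k*3+k*3≡T*3)
      (subst (λ m → Linked _⟶_ ((m , T * 3) ∷ lowerLevels h)) (sym K≡2h) (lowerLevels-linked h (≤-reflexive (sym K≡2h)))))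

  path-K-odd-linked : ∀ h → K ≡ suc (h * 2) → Linked _⟶_ (lowerLevels (suc h))
  path-K-odd-linked h K≡2h+1 = twoLevels-linked (h * 2) (≤-reflexive (sym K≡2h+1)) (lowerLevels h)
    (lowerLevels-linked h (≤-trans (n≤1+n _) (≤-reflexive (sym K≡2h+1))))

  OnLevels : ℕ → ℕ → Index → Set
  OnLevels b t (m , t′) = (m ≡ b ⊎ m ≡ suc b) × t′ < t

  ladder-on : ∀ b t → All (OnLevels b t) (ladder b t)
  ladder-on b zero = []
  ladder-on b (suc t) = (inj₁ refl , ≤-refl) ∷ (inj₂ refl , ≤-refl) ∷ All.map (λ (on , t′<t) → on , m<n⇒m<1+n t′<t) (ladder-on b t)

  index≢ : ∀ {p q : Index} → proj₂ p ≢ proj₂ q → p ≢ q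
  index≢ t≢t′ p≡q = t≢t′ (cong proj₂ p≡q)

  ladder-distinct : ∀ b t → AllPairs _≢_ (ladder b t)
  ladder-distinct b zero = []
  ladder-distinct b (suc t) =
       ((λ e → <-irrefl (cong proj₁ e) (n<1+n b)) ∷ All.map (λ (_ , t′<t) → index≢ (>⇒≢ t′<t)) (ladder-on b t))
     ∷ All.map (λ (_ , t′<t) → index≢ (>⇒≢ t′<t)) (ladder-on b t)
     ∷ ladder-distinct b t

  twoLevels-on : ∀ b → All (OnLevels b n) (twoLevels b)
  twoLevels-on b = (inj₂ refl , ≤-refl)
    ∷ All.++⁺ (All.map (λ (on , t<3T) → on , <-trans t<3T ≤-refl) (ladder-on b (T * 3))) ((inj₁ refl , ≤-refl) ∷ [])

  twoLevels-distinct : ∀ b → AllPairs _≢_ (twoLevels b)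
  twoLevels-distinct b =
       All.++⁺ (All.map (λ (_ , t<3T) → index≢ (>⇒≢ t<3T)) (ladder-on b (T * 3))) ((λ e → <-irrefl (sym (cong proj₁ e)) (n<1+n b)) ∷ [])
     ∷ AllPairs.++⁺ (ladder-distinct b (T * 3)) ([] ∷ []) (All.map (λ (_ , t<3T) → index≢ (<⇒≢ t<3T) ∷ []) (ladder-on b (T * 3)))

  Below : ℕ → Index → Set
  Below b (m , t) = m < b × t < n

  lowerLevels-below : ∀ h → All (Below (h * 2)) (lowerLevels h)
  lowerLevels-below zero = []
  lowerLevels-below (suc h) = All.++⁺ (All.map below (twoLevels-on (h * 2)))
    (All.map (λ (m<2h , t<n) → ≤-trans m<2h (≤-trans (n≤1+n _) (n≤1+n _)) , t<n) (lowerLevels-below h))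
    where
    below : ∀ {p} → OnLevels (h * 2) n p → Below (suc h * 2) p
    below (inj₁ refl , t<n) = s≤s (n≤1+n (h * 2)) , t<n
    below (inj₂ refl , t<n) = ≤-refl , t<n

  lowerLevels-distinct : ∀ h → AllPairs _≢_ (lowerLevels h)
  lowerLevels-distinct zero = []
  lowerLevels-distinct (suc h) = AllPairs.++⁺ (twoLevels-distinct (h * 2)) (lowerLevels-distinct h)
    (All.map (λ on → All.map (apart on) (lowerLevels-below h)) (twoLevels-on (h * 2)))
    where
    apart : ∀ {p q} → OnLevels (h * 2) n p → Below (h * 2) q → p ≢ q
    apart (inj₁ refl , _) (m<2h , _) refl = <-irrefl refl m<2h
    apart (inj₂ refl , _) (m<2h , _) refl = <-irrefl refl (≤-trans (n≤1+n _) m<2h)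

  OnTopRun : ℕ → ℕ → Index → Set
  OnTopRun j l (m , t) = m ≡ K × j ≤ t × (t < j + l ⊎ suc (j + k * 3) ≤ t) × t < j + l + suc (k * 3)

  topRun-on : ∀ j l → All (OnTopRun j l) (topRun j l)
  topRun-on j zero = []
  topRun-on j (suc l) = (refl , ≤-refl , inj₁ (m<m+n j (s≤s z≤n)) , ≤-trans (m<m+n j (s≤s z≤n)) (m≤m+n _ _))
    ∷ (refl , m≤m+n j _ , inj₂ (≤-reflexive (sym (+-suc j (k * 3)))) , +-monoˡ-< (suc (k * 3)) (m<m+n j (s≤s z≤n)))
    ∷ All.map widen (topRun-on (suc j) l)
    where
    j+1+l≡j+l+1 : suc j + l ≡ j + suc l
    j+1+l≡j+l+1 = sym (+-suc j l)
    widen : ∀ {p} → OnTopRun (suc j) l p → OnTopRun j (suc l) p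
    widen {_ , t} (refl , j<t , inj₁ t<j+l , t<end) =
      refl , <⇒≤ j<t , inj₁ (subst (t <_) j+1+l≡j+l+1 t<j+l) , subst (λ z → t < z + suc (k * 3)) j+1+l≡j+l+1 t<end
    widen {_ , t} (refl , j<t , inj₂ j+3k+1<t , t<end) =
      refl , <⇒≤ j<t , inj₂ (≤-trans (n≤1+n _) j+3k+1<t) , subst (λ z → t < z + suc (k * 3)) j+1+l≡j+l+1 t<end

  topRun-distinct : ∀ j l → j + l ≤ k * 3 → AllPairs _≢_ (topRun j l)
  topRun-distinct j zero _ = []
  topRun-distinct j (suc l) j+l+1≤3k =
       (index≢ (<⇒≢ (m<m+n j (s≤s z≤n))) ∷ All.map (λ (_ , j<t , _) → index≢ (<⇒≢ j<t)) (topRun-on (suc j) l))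
     ∷ All.map apart (topRun-on (suc j) l)
     ∷ topRun-distinct (suc j) l (subst (_≤ k * 3) (+-suc j l) j+l+1≤3k)
    where
    apart : ∀ {p} → OnTopRun (suc j) l p → (K , j + suc (k * 3)) ≢ p
    apart (_ , _ , inj₁ t<j+1+l , _) = index≢ (>⇒≢ (<-≤-trans t<j+1+l
      (≤-trans (subst (_≤ k * 3) (+-suc j l) j+l+1≤3k) (≤-trans (m≤n+m (k * 3) j) (+-monoʳ-≤ j (n≤1+n _))))))
    apart {_ , t} (_ , _ , inj₂ j+3k+2≤t , _) = index≢ (<⇒≢ (subst (_< t) (sym (+-suc j (k * 3))) j+3k+2≤t))

  topLevel-on : All (λ (m , t) → m ≡ K × t < n) topLevel
  topLevel-on = (refl , ≤-trans (s≤s (m≤m+n (k * 3) (k * 3))) (≤-reflexive (cong suc k*3+k*3≡T*3)))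
    ∷ All.map (λ {(_ , t)} (K≡ , _ , _ , t<end) → K≡ , subst (t <_) (sym n≡3k+1+3k) t<end) (topRun-on 0 (k * 3))

  topLevel-distinct : AllPairs _≢_ topLevel
  topLevel-distinct = All.map apart (topRun-on 0 (k * 3)) ∷ topRun-distinct 0 (k * 3) ≤-refl
    where
    apart : ∀ {p} → OnTopRun 0 (k * 3) p → (K , k * 3) ≢ p
    apart (_ , _ , inj₁ t<3k , _) = index≢ (>⇒≢ t<3k)
    apart (_ , _ , inj₂ 3k<t , _) = index≢ (<⇒≢ 3k<t)

  ∈-ladder : ∀ b t i → i < t → (b , i) ∈ₗ ladder b t × (suc b , i) ∈ₗ ladder b t
  ∈-ladder b (suc t) i i<t with m<1+n⇒m<n∨m≡n i<t
  ... | inj₂ refl = here refl , there (here refl)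
  ... | inj₁ i<t′ = there (there (proj₁ (∈-ladder b t i i<t′))) , there (there (proj₂ (∈-ladder b t i i<t′)))

  ∈-twoLevels : ∀ b i → i < n → (b , i) ∈ₗ twoLevels b × (suc b , i) ∈ₗ twoLevels b
  ∈-twoLevels b i i<n with m<1+n⇒m<n∨m≡n i<n
  ... | inj₂ refl = there (∈-++⁺ʳ (ladder b (T * 3)) (here refl)) , here refl
  ... | inj₁ i<3T = there (∈-++⁺ˡ (proj₁ (∈-ladder b (T * 3) i i<3T))) , there (∈-++⁺ˡ (proj₂ (∈-ladder b (T * 3) i i<3T)))

  ∈-lowerLevels : ∀ h m i → m < h * 2 → i < n → (m , i) ∈ₗ lowerLevels h
  ∈-lowerLevels (suc h) m i m<2h+2 i<n with m<1+n⇒m<n∨m≡n m<2h+2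
  ... | inj₂ refl = ∈-++⁺ˡ (proj₂ (∈-twoLevels (h * 2) i i<n))
  ... | inj₁ m<2h+1 with m<1+n⇒m<n∨m≡n m<2h+1
  ...   | inj₂ refl = ∈-++⁺ˡ (proj₁ (∈-twoLevels (h * 2) i i<n))
  ...   | inj₁ m<2h = ∈-++⁺ʳ (twoLevels (h * 2)) (∈-lowerLevels h m i m<2h i<n)

  ∈-topRun : ∀ j l i → i < l → (K , j + i) ∈ₗ topRun j l × (K , (j + i) + suc (k * 3)) ∈ₗ topRun j l
  ∈-topRun j (suc l) zero _ = here (cong (K ,_) (+-identityʳ j)) , there (here (cong (λ z → K , z + suc (k * 3)) (+-identityʳ j)))
  ∈-topRun j (suc l) (suc i) i<l =
      there (there (subst (λ z → (K , z) ∈ₗ topRun (suc j) l) (sym (+-suc j i)) (proj₁ later)))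
    , there (there (subst (λ z → (K , z + suc (k * 3)) ∈ₗ topRun (suc j) l) (sym (+-suc j i)) (proj₂ later)))
    where later = ∈-topRun (suc j) l i (s≤s⁻¹ i<l)

  ∈-topLevel : ∀ t → t < n → (K , t) ∈ₗ topLevel
  ∈-topLevel t t<n with <-cmp t (k * 3)
  ... | tri≈ _ refl _ = here refl
  ... | tri< t<3k _ _ = there (proj₁ (∈-topRun 0 (k * 3) t t<3k))
  ... | tri> _ _ 3k<t with m≤n⇒∃[o]m+o≡n 3k<t
  ...   | j , refl = there (subst (λ z → (K , z) ∈ₗ topRun 0 (k * 3)) (+-comm j (suc (k * 3))) (proj₂ (∈-topRun 0 (k * 3) j j<3k)))
    where
    j<3k : j < k * 3
    j<3k = +-cancelˡ-< (suc (k * 3)) j (k * 3) (subst (suc (k * 3) + j <_) (trans n≡3k+1+3k (+-comm (k * 3) _)) t<n)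

  record IndexPath (indices : List Index) : Set where
    field
      distinct : AllPairs _≢_ indices
      in-range : All InRange indices
      linked : Linked _⟶_ indices
      complete : ∀ m t → m ≤ K → t < n → (m , t) ∈ₗ indices

  setAt-distinct : ∀ {indices} → AllPairs _≢_ indices → All InRange indices → AllPairs _≢_ (map setAt indices)
  setAt-distinct [] [] = []
  setAt-distinct (p≢ ∷ distinct) (p-in ∷ in-range) = All.map⁺ (apart p≢ p-in in-range) ∷ setAt-distinct distinct in-range
    where
    apart : ∀ {p qs} → All (p ≢_) qs → InRange p → All InRange qs → All (λ q → setAt p ≢ setAt q) qs
    apart [] _ [] = []
    apart {m , t} {(m′ , t′) ∷ _} (p≢q ∷ p≢qs) p-in@(m≤K , t<n) ((m′≤K , t′<n) ∷ qs-in) = different ∷ apart p≢qs p-in qs-in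
      where
      different : setAt (m , t) ≢ setAt (m′ , t′)
      different sets≡ with canonicalSet-injective m m′ (t * 3) (t′ * 3) m≤K m′≤K sets≡
      ... | m≡m′ , 3t≡3t′ = p≢q (cong₂ _,_ m≡m′ (*3-injective t t′ t<n t′<n 3t≡3t′))

  IndexPath⇒traceable : ∀ {indices} → IndexPath indices → IGraphTraceable (CycleAdj n)
  IndexPath⇒traceable {indices} path = map setAt indices
    , All.map⁺ (All.map (λ (m≤K , _) → canonicalSet-iset _ _ m≤K) in-range)
    , setAt-distinct distinct in-range
    , (λ X iset → listed X (iset⇒indexed X iset))
    , Linked.map⁺ linked
    where
    open IndexPath path
    listed : ∀ X → (Σ ℕ λ m → Σ ℕ λ t → m ≤ K × t < n × X ≡ canonicalSet m (t * 3)) → X ∈ₗ map setAt indices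
    listed X (m , t , m≤K , t<n , X≡) = subst (_∈ₗ map setAt indices) (sym X≡) (∈-map⁺ setAt (complete m t m≤K t<n))

  path-K-even : ∀ h → K ≡ h * 2 → IndexPath (topLevel ++ lowerLevels h)
  path-K-even h K≡2h = record
    { distinct = AllPairs.++⁺ topLevel-distinct (lowerLevels-distinct h)
        (All.map (λ (m≡K , _) → All.map (λ (m′<2h , _) e → <-irrefl (trans (sym (cong proj₁ e)) (trans m≡K K≡2h)) m′<2h) (lowerLevels-below h)) topLevel-on)
    ; in-range = All.++⁺ (All.map (λ (m≡K , t<n) → ≤-reflexive m≡K , t<n) topLevel-on)
        (All.map (λ {(m , _)} (m<2h , t<n) → <⇒≤ (subst (m <_) (sym K≡2h) m<2h) , t<n) (lowerLevels-below h))
    ; linked = path-K-even-linked h K≡2h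
    ; complete = complete
    }
    where
    complete : ∀ m t → m ≤ K → t < n → (m , t) ∈ₗ (topLevel ++ lowerLevels h)
    complete m t m≤K t<n with m≤n⇒m<n∨m≡n m≤K
    ... | inj₂ refl = ∈-++⁺ˡ (∈-topLevel t t<n)
    ... | inj₁ m<K = ∈-++⁺ʳ topLevel (∈-lowerLevels h m t (subst (m <_) K≡2h m<K) t<n)

  path-K-odd : ∀ h → K ≡ suc (h * 2) → IndexPath (lowerLevels (suc h))
  path-K-odd h K≡2h+1 = record
    { distinct = lowerLevels-distinct (suc h)
    ; in-range = All.map (λ {(m , _)} (m<2h+2 , t<n) → s≤s⁻¹ (subst (m <_) (cong suc (sym K≡2h+1)) m<2h+2) , t<n) (lowerLevels-below (suc h))
    ; linked = path-K-odd-linked h K≡2h+1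
    ; complete = λ m t m≤K t<n → ∈-lowerLevels (suc h) m t (subst (m <_) (cong suc K≡2h+1) (s≤s m≤K)) t<n
    }

  traceable : IGraphTraceable (CycleAdj n)
  traceable with even-or-odd K
  ... | inj₁ (h , K≡2h) = IndexPath⇒traceable (path-K-even h K≡2h)
  ... | inj₂ (h , K≡2h+1) = IndexPath⇒traceable (path-K-odd h K≡2h+1)

mainTheorem5 : (k : ℕ) → 3 ≤ k → IGraphTraceable (CycleAdj (6 * k + 1))
mainTheorem5 zero ()
mainTheorem5 (suc K) _ = subst (λ N → IGraphTraceable (CycleAdj N)) (sym (6k+1≡n K)) (Path.traceable K)
  where
  6k+1≡n : ∀ K → 6 * suc K + 1 ≡ suc (suc (suc (K * 2)) * 3)
  6k+1≡n = solve-∀
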